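{- Let $r\ge1$ be an integer and let $P_n$ be the path on $n$ vertices, where $n=(2r+1)p+q$ with $p\ge1$ an integer and $q\in\{0,1,\dots,2r\}$. Then: (1) if $q=0$: $M_r^I(P_n)=\frac{(2r+1)p}{2}+1$ if $p$ is even, and $M_r^I(P_n)=\frac{(2r+1)(p-1)}{2}+2r$ if $p$ is odd; (2) if $1\le q\le r+1$: $M_r^I(P_n)=\frac{(2r+1)p}{2}+q$ if $p$ is even, and $M_r^I(P_n)=\frac{(2r+1)(p-1)}{2}+2r+1$ if $p$ is odd; (3) if $r+2\le q\le 2r$: $M_r^I(P_n)=\frac{(2r+1)p}{2}+q-1$ if $p$ is even, and $M_r^I(P_n)=\frac{(2r+1)(p-1)}{2}+2r+1$ if $p$ is odd.
   Context: For a graph $G=(V,E)$ and integer $r\ge1$, $d(x,y)$ is the number of edges in a shortest path between $x$ and $y$, $N_r[x]=\{y\in V: d(x,y)\le r\}$, and for $D\subseteq V$, $D_r(x)=N_r[x]\cap D$. A set $D\subseteq V$ is an $r$-identifying code ($r$-IC) of $G$ if $D_r(x)\neq\emptyset$ for every $x\in V$ and $D_r(x)\neq D_r(y)$ for all distinct $x,y\in V$. $M_r^I(G)$ denotes the minimum cardinality of an $r$-identifying code of $G$. -}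

module Defs where

open import Data.Nat using (ℕ; _≤_; _≤?_; ∣_-_∣)
open import Data.Fin using (Fin; toℕ)
open import Data.Fin.Subset using (Subset; _∩_; Nonempty; ∣_∣)
open import Data.Vec using (tabulate)
open import Data.Product using (Σ; _×_)
open import Relation.Nullary using (¬_)
open import Relation.Nullary.Decidable using (⌊_⌋)
open import Relation.Binary.PropositionalEquality using (_≡_; _≢_)

-- The path P_n has vertex set Fin n, with i adjacent to j iff |i - j| = 1.
-- Its shortest-path distance is d(i,j) = |i - j|.
pathDist : {n : ℕ} → Fin n → Fin n → ℕ
pathDist i j = ∣ toℕ i - toℕ j ∣

ball : {n : ℕ} → ℕ → Fin n → Subset n
ball r x = tabulate (λ y → ⌊ pathDist x y ≤? r ⌋)

codeSet : {n : ℕ} → ℕ → Subset n → Fin n → Subset n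
codeSet r D x = ball r x ∩ D

IsIdCode : (r n : ℕ) → Subset n → Set
IsIdCode r n D =
  ((x : Fin n) → Nonempty (codeSet r D x)) ×
  ((x y : Fin n) → x ≢ y → codeSet r D x ≢ codeSet r D y)

MinIdCodeSize : (r n m : ℕ) → Set
MinIdCodeSize r n m =
  Σ (Subset n) (λ D → IsIdCode r n D × ∣ D ∣ ≡ m) ×
  ((D : Subset n) → IsIdCode r n D → m ≤ ∣ D ∣)

-- Let m = 2r + 1. The vertices of P_n fall into m residue classes modulo m, each a chain of
-- p or p + 1 vertices spaced m apart. An identifying code must separate v + r from v + r + 1,
-- which forces v or v + m into the code: along every chain no two consecutive vertices are
-- missing, so a chain of length L carries at least ⌈(L - 1)/2⌉ code vertices, and one more when
-- an end of an odd chain, or both ends of an even one, are in the code. The pairs near the two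
-- ends of the path force the vertices r + 1, …, 2r and n - 2r - 1, …, n - r - 2, which start or
-- end chains, and dominating 0 and n - 1 forces a little more; adding up these per-chain bounds
-- gives the lower bound. Conversely, taking the even or the odd positions of every chain, with
-- the parities and ends arranged case by case, gives codes of exactly that size: three chains of
-- alternating parity put a code vertex in every window of m consecutive vertices, and together
-- with the forced ends this yields separation and domination.

module Submission where

open import Defs
open import Data.Nat using (ℕ; zero; suc; _+_; _*_; _∸_; _/_; _%_; _≤_; _<_; z≤n; s≤s; _<?_; _≤?_; pred; _≡ᵇ_; ∣_-_∣)
open import Data.Nat.Properties
open import Data.Nat.DivMod
open import Data.Nat.Divisibility using (divides-refl)
open import Data.Nat.Tactic.RingSolver using (solve-∀)
open import Algebra.Properties.CommutativeSemigroup +-commutativeSemigroup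
  using () renaming (interchange to +-interchange)
open import Data.Bool using (Bool; true; false; not; _∧_; _∨_)
open import Data.Bool.Properties using (∨-zeroʳ; ∨-identityʳ)
import Data.Bool.Properties as Bool
open import Data.Fin using (Fin; toℕ; fromℕ<) renaming (zero to fzero; suc to fsuc)
open import Data.Fin.Properties using (toℕ-injective; toℕ<n; toℕ-fromℕ<; ¬∀⟶∃¬)
open import Data.Fin.Subset using (Subset; Nonempty; ∣_∣)
open import Data.Vec using ([]; _∷_; lookup; tabulate)
open import Data.Vec.Properties using (lookup∘tabulate; tabulate∘lookup; tabulate-cong; lookup-zipWith; []=⇒lookup; lookup⇒[]=)
open import Data.Product using (Σ; _×_; _,_; proj₁; proj₂)
open import Data.Sum using (_⊎_; inj₁; inj₂)
open import Data.Empty using (⊥; ⊥-elim)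
open import Relation.Nullary using (yes; no)
open import Relation.Nullary.Decidable using (⌊_⌋)
open import Relation.Binary.Definitions using (tri<; tri≈; tri>)
open import Relation.Binary.PropositionalEquality

∑ : (ℕ → ℕ) → ℕ → ℕ
∑ f zero = 0
∑ f (suc k) = ∑ f k + f k

∑-head : ∀ f k → ∑ f (suc k) ≡ f 0 + ∑ (λ i → f (suc i)) k
∑-head f zero = +-comm 0 (f 0)
∑-head f (suc k) = trans (cong (_+ f (suc k)) (∑-head f k)) (+-assoc (f 0) _ _)

∑-split : ∀ f a b → ∑ f (a + b) ≡ ∑ f a + ∑ (λ i → f (a + i)) b
∑-split f a zero = trans (cong (∑ f) (+-identityʳ a)) (sym (+-identityʳ _))
∑-split f a (suc b) = trans (cong (∑ f) (+-suc a b))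
  (trans (cong (_+ f (a + b)) (∑-split f a b)) (+-assoc (∑ f a) _ _))

∑-cong : ∀ {f g} k → (∀ i → i < k → f i ≡ g i) → ∑ f k ≡ ∑ g k
∑-cong zero h = refl
∑-cong (suc k) h = cong₂ _+_ (∑-cong k (λ i i<k → h i (m<n⇒m<1+n i<k))) (h k ≤-refl)

∑-mono : ∀ {f g} k → (∀ i → i < k → f i ≤ g i) → ∑ f k ≤ ∑ g k
∑-mono zero h = z≤n
∑-mono (suc k) h = +-mono-≤ (∑-mono k (λ i i<k → h i (m<n⇒m<1+n i<k))) (h k ≤-refl)

∑-mono-< : ∀ {f g} k c → (∀ i → i < k → f i ≤ g i) → c < k → f c < g c → ∑ f k < ∑ g k
∑-mono-< (suc k) c h c<1+k fc<gc with c <? k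
... | yes c<k = +-mono-<-≤ (∑-mono-< k c (λ i i<k → h i (m<n⇒m<1+n i<k)) c<k fc<gc) (h k ≤-refl)
... | no c≮k rewrite ≤-antisym (≤-pred c<1+k) (≮⇒≥ c≮k) =
  +-mono-≤-< (∑-mono k (λ i i<k → h i (m<n⇒m<1+n i<k))) fc<gc

∑-distrib : ∀ f g k → ∑ (λ i → f i + g i) k ≡ ∑ f k + ∑ g k
∑-distrib f g zero = refl
∑-distrib f g (suc k) =
  trans (cong (_+ (f k + g k)) (∑-distrib f g k)) (+-interchange (∑ f k) (∑ g k) (f k) (g k))

∑-const : ∀ v k → ∑ (λ _ → v) k ≡ k * v
∑-const v zero = refl
∑-const v (suc k) = trans (cong (_+ v) (∑-const v k)) (+-comm (k * v) v)

∑-swap : ∀ (f : ℕ → ℕ → ℕ) a b →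
         ∑ (λ i → ∑ (λ j → f i j) b) a ≡ ∑ (λ j → ∑ (λ i → f i j) a) b
∑-swap f zero b = sym (trans (∑-cong b (λ _ _ → refl)) (trans (∑-const 0 b) (*-zeroʳ b)))
∑-swap f (suc a) b = trans (cong (_+ ∑ (f a) b) (∑-swap f a b))
  (sym (∑-distrib (λ j → ∑ (λ i → f i j) a) (f a) b))

ifBelow : ∀ {A : Set} → ℕ → ℕ → A → A → A
ifBelow c a x y with c <? a
... | yes _ = x
... | no _ = y

ifBelow-< : ∀ {A : Set} {c a} {x y : A} → c < a → ifBelow c a x y ≡ x
ifBelow-< {c = c} {a} c<a with c <? a
... | yes _ = refl
... | no c≮a = ⊥-elim (c≮a c<a)

ifBelow-≥ : ∀ {A : Set} {c a} {x y : A} → a ≤ c → ifBelow c a x y ≡ y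
ifBelow-≥ {c = c} {a} a≤c with c <? a
... | yes c<a = ⊥-elim (<⇒≱ c<a a≤c)
... | no _ = refl

below : ℕ → ℕ → ℕ
below i b = ifBelow i b 1 0

below-mono : ∀ i {a b} → a ≤ b → below i a ≤ below i b
below-mono i {a} {b} a≤b with ≤-<-connex a i
... | inj₂ i<a = ≤-reflexive (trans (ifBelow-< i<a) (sym (ifBelow-< (<-≤-trans i<a a≤b))))
... | inj₁ a≤i = subst (_≤ below i b) (sym (ifBelow-≥ a≤i)) z≤n

∑-below : ∀ b k → b ≤ k → ∑ (λ i → below i b) k ≡ b
∑-below b k b≤k = begin
  ∑ (λ i → below i b) k                                     ≡⟨ cong (∑ _) (sym (m+[n∸m]≡n b≤k)) ⟩
  ∑ (λ i → below i b) (b + (k ∸ b))                         ≡⟨ ∑-split _ b (k ∸ b) ⟩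
  ∑ (λ i → below i b) b + ∑ (λ i → below (b + i) b) (k ∸ b)
    ≡⟨ cong₂ _+_ (∑-cong b (λ _ i<b → ifBelow-< i<b)) (∑-cong (k ∸ b) (λ i _ → ifBelow-≥ (m≤m+n b i))) ⟩
  ∑ (λ _ → 1) b + ∑ (λ _ → 0) (k ∸ b)                       ≡⟨ cong₂ _+_ (∑-const 1 b) (∑-const 0 (k ∸ b)) ⟩
  b * 1 + (k ∸ b) * 0                                       ≡⟨ cong₂ _+_ (*-identityʳ b) (*-zeroʳ (k ∸ b)) ⟩
  b + 0                                                     ≡⟨ +-identityʳ b ⟩
  b                                                         ∎
  where open ≡-Reasoning

between : ℕ → ℕ → ℕ → ℕ
between a b i = below i b ∸ below i a

between-in : ∀ {a b i} → a ≤ i → i < b → between a b i ≡ 1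
between-in a≤i i<b = cong₂ _∸_ (ifBelow-< i<b) (ifBelow-≥ a≤i)

between-< : ∀ {a b i} → i < a → a ≤ b → between a b i ≡ 0
between-< i<a a≤b = cong₂ _∸_ (ifBelow-< (<-≤-trans i<a a≤b)) (ifBelow-< i<a)

between-≥ : ∀ a {b i} → b ≤ i → between a b i ≡ 0
between-≥ a {b} {i} b≤i = trans (cong (_∸ below i a) (ifBelow-≥ b≤i)) (0∸n≡0 (below i a))

∑-between : ∀ a b k → a ≤ b → b ≤ k → ∑ (between a b) k ≡ b ∸ a
∑-between a b k a≤b b≤k = begin
  ∑ (between a b) k                         ≡⟨ sym (m+n∸n≡m _ (∑ χa k)) ⟩
  ∑ (between a b) k + ∑ χa k ∸ ∑ χa k      ≡⟨ cong (_∸ ∑ χa k) (sym (∑-distrib (between a b) χa k)) ⟩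
  ∑ (λ i → between a b i + χa i) k ∸ ∑ χa k
    ≡⟨ cong (_∸ ∑ χa k) (∑-cong k (λ i _ → m∸n+n≡m (below-mono i a≤b))) ⟩
  ∑ (λ i → below i b) k ∸ ∑ χa k            ≡⟨ cong₂ _∸_ (∑-below b k b≤k) (∑-below a k (≤-trans a≤b b≤k)) ⟩
  b ∸ a                                     ∎
  where
  open ≡-Reasoning
  χa : ℕ → ℕ
  χa i = below i a

∑-const+between : ∀ v a b k → a ≤ b → b ≤ k → ∑ (λ c → v + between a b c) k ≡ k * v + (b ∸ a)
∑-const+between v a b k a≤b b≤k =
  trans (∑-distrib (λ _ → v) (between a b) k) (cong₂ _+_ (∑-const v k) (∑-between a b k a≤b b≤k))

∑-const+between₂ : ∀ v a b a′ b′ k → a ≤ b → b ≤ k → a′ ≤ b′ → b′ ≤ k →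
                   ∑ (λ c → v + (between a b c + between a′ b′ c)) k ≡ k * v + ((b ∸ a) + (b′ ∸ a′))
∑-const+between₂ v a b a′ b′ k a≤b b≤k a′≤b′ b′≤k =
  trans (∑-distrib (λ _ → v) (λ c → between a b c + between a′ b′ c) k)
        (cong₂ _+_ (∑-const v k) (trans (∑-distrib (between a b) (between a′ b′) k)
                                         (cong₂ _+_ (∑-between a b k a≤b b≤k) (∑-between a′ b′ k a′≤b′ b′≤k))))

∑-blocks : ∀ f m p → ∑ f (p * m) ≡ ∑ (λ j → ∑ (λ c → f (c + j * m)) m) p
∑-blocks f m zero = refl
∑-blocks f m (suc p) = begin
  ∑ f (m + p * m)                            ≡⟨ cong (∑ f) (+-comm m (p * m)) ⟩
  ∑ f (p * m + m)                            ≡⟨ ∑-split f (p * m) m ⟩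
  ∑ f (p * m) + ∑ (λ i → f (p * m + i)) m
    ≡⟨ cong₂ _+_ (∑-blocks f m p) (∑-cong m (λ i _ → cong f (+-comm (p * m) i))) ⟩
  ∑ (λ j → ∑ (λ c → f (c + j * m)) m) p + ∑ (λ c → f (c + p * m)) m ∎
  where open ≡-Reasoning

classSize : ℕ → ℕ → ℕ → ℕ
classSize p q c = p + below c q

classSum : (ℕ → ℕ) → ℕ → ℕ → ℕ → ℕ → ℕ
classSum f m p q c = ∑ (λ j → f (c + j * m)) (classSize p q c)

∑-byClass : ∀ f m p q → q ≤ m → ∑ f (p * m + q) ≡ ∑ (classSum f m p q) m
∑-byClass f m p q q≤m = begin
  ∑ f (p * m + q)                                 ≡⟨ ∑-split f (p * m) q ⟩
  ∑ f (p * m) + ∑ (λ i → f (p * m + i)) q         ≡⟨ cong₂ _+_ (∑-blocks f m p) remainder ⟩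
  ∑ (λ j → ∑ (λ c → f (c + j * m)) m) p + ∑ extra m
    ≡⟨ cong (_+ ∑ extra m) (∑-swap (λ j c → f (c + j * m)) p m) ⟩
  ∑ full m + ∑ extra m                             ≡⟨ sym (∑-distrib full extra m) ⟩
  ∑ (λ c → full c + extra c) m
    ≡⟨ ∑-cong m (λ c _ → sym (∑-split (λ j → f (c + j * m)) p (below c q))) ⟩
  ∑ (classSum f m p q) m                          ∎
  where
  open ≡-Reasoning
  full : ℕ → ℕ
  full c = ∑ (λ j → f (c + j * m)) p
  extra : ℕ → ℕ
  extra c = ∑ (λ i → f (c + (p + i) * m)) (below c q)
  extra-< : ∀ c → c < q → extra c ≡ f (p * m + c)
  extra-< c c<q rewrite ifBelow-< {x = 1} {y = 0} c<q | +-identityʳ p = cong f (+-comm c (p * m))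
  extra-≥ : ∀ c → q ≤ c → extra c ≡ 0
  extra-≥ c q≤c rewrite ifBelow-≥ {x = 1} {y = 0} q≤c = refl
  remainder : ∑ (λ i → f (p * m + i)) q ≡ ∑ extra m
  remainder = begin
    ∑ (λ i → f (p * m + i)) q                   ≡⟨ ∑-cong q (λ c c<q → sym (extra-< c c<q)) ⟩
    ∑ extra q                                   ≡⟨ sym (+-identityʳ _) ⟩
    ∑ extra q + 0
      ≡⟨ cong (∑ extra q +_) (sym (trans (∑-cong (m ∸ q) (λ i _ → extra-≥ (q + i) (m≤m+n q i)))
                                          (trans (∑-const 0 (m ∸ q)) (*-zeroʳ (m ∸ q))))) ⟩
    ∑ extra q + ∑ (λ i → extra (q + i)) (m ∸ q) ≡⟨ sym (∑-split extra q (m ∸ q)) ⟩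
    ∑ extra (q + (m ∸ q))                       ≡⟨ cong (∑ extra) (m+[n∸m]≡n q≤m) ⟩
    ∑ extra m                                   ∎

-- Chains without two consecutive gaps

-- Adding the K inequalities for adjacent pairs counts every interior term twice.
chain-bound : ∀ (e : ℕ → ℕ) K → (∀ j → suc j < suc K → 1 ≤ e j + e (suc j)) →
              suc K + e 0 + e K ≤ 2 * ∑ e (suc K) + 1
chain-bound e zero _ = ≤-reflexive (base (e 0))
  where
  base : ∀ a → 1 + a + a ≡ 2 * (0 + a) + 1
  base = solve-∀
chain-bound e (suc K) adjacent = +-cancelʳ-≤ (e K) _ _ (begin
  suc (suc K) + e 0 + e (suc K) + e K   ≡⟨ regroup K (e 0) (e (suc K)) (e K) ⟩
  (suc K + e 0 + e K) + (1 + e (suc K))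
    ≤⟨ +-mono-≤ (chain-bound e K (λ j sj<sK → adjacent j (m<n⇒m<1+n sj<sK)))
                (+-monoˡ-≤ (e (suc K)) (adjacent K ≤-refl)) ⟩
  (2 * S + 1) + (e K + e (suc K) + e (suc K)) ≡⟨ collect S (e K) (e (suc K)) ⟩
  2 * (S + e (suc K)) + 1 + e K         ∎)
  where
  open ≤-Reasoning
  S = ∑ e (suc K)
  regroup : ∀ k a b c → suc (suc k) + a + b + c ≡ (suc k + a + c) + (1 + b)
  regroup = solve-∀
  collect : ∀ s a b → (2 * s + 1) + (a + b + b) ≡ 2 * (s + b) + 1 + a
  collect = solve-∀

2*-suc : ∀ u → 2 * suc u ≡ suc (suc (2 * u))
2*-suc = solve-∀

double-suc : ∀ u → 2 * suc u ≡ suc (2 * u) + 1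
double-suc = solve-∀

halve-≤ : ∀ x y → 2 * x ≤ 2 * y + 1 → x ≤ y
halve-≤ x y 2x≤2y+1 = ≮⇒≥ λ y<x →
  1+n≰n (≤-trans (≤-reflexive (sym (double-suc y))) (≤-trans (*-monoʳ-≤ 2 y<x) 2x≤2y+1))

module _ {L a b S : ℕ} where

  odd-chain : ∀ u → L ≡ suc (2 * u) → L + a + b ≤ 2 * S + 1 → u ≤ S
  odd-chain u refl bound =
    halve-≤ u S (≤-trans (≤-trans (n≤1+n _) (≤-trans (m≤m+n _ a) (m≤m+n _ b))) bound)

  odd-chain-end : ∀ u → L ≡ suc (2 * u) → a ≡ 1 ⊎ b ≡ 1 → L + a + b ≤ 2 * S + 1 → suc u ≤ S
  odd-chain-end u refl (inj₁ refl) bound =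
    halve-≤ (suc u) S (≤-trans (≤-reflexive (double-suc u)) (≤-trans (m≤m+n _ b) bound))
  odd-chain-end u refl (inj₂ refl) bound =
    halve-≤ (suc u) S (≤-trans (≤-reflexive (double-suc u)) (≤-trans (+-monoˡ-≤ 1 (m≤m+n (suc (2 * u)) a)) bound))

  even-chain : ∀ u → L ≡ suc (suc (2 * u)) → L + a + b ≤ 2 * S + 1 → suc u ≤ S
  even-chain u refl bound =
    halve-≤ (suc u) S (≤-trans (≤-reflexive (2*-suc u)) (≤-trans (m≤m+n _ a) (≤-trans (m≤m+n _ b) bound)))

  even-chain-ends : ∀ u → L ≡ suc (suc (2 * u)) → a ≡ 1 → b ≡ 1 → L + a + b ≤ 2 * S + 1 → suc (suc u) ≤ S
  even-chain-ends u refl refl refl bound = halve-≤ (suc (suc u)) S (≤-trans (≤-reflexive (double-suc-suc u)) bound)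
    where
    double-suc-suc : ∀ u → 2 * suc (suc u) ≡ suc (suc (2 * u)) + 1 + 1
    double-suc-suc = solve-∀

isOdd : ℕ → Bool
isOdd zero = false
isOdd (suc zero) = true
isOdd (suc (suc j)) = isOdd j

isOdd-suc : ∀ j → isOdd (suc j) ≡ not (isOdd j)
isOdd-suc zero = refl
isOdd-suc (suc zero) = refl
isOdd-suc (suc (suc j)) = isOdd-suc j

isOdd-2* : ∀ u → isOdd (2 * u) ≡ false
isOdd-2* zero = refl
isOdd-2* (suc u) = trans (cong isOdd (2*-suc u)) (isOdd-2* u)

isOdd-1+2* : ∀ u → isOdd (suc (2 * u)) ≡ true
isOdd-1+2* u = trans (isOdd-suc (2 * u)) (cong not (isOdd-2* u))

bit : Bool → ℕ
bit true = 1
bit false = 0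

data Pattern : Set where
  odds evens first+odds evens+last : Pattern

selects : Pattern → ℕ → ℕ → Bool
selects odds L j = isOdd j
selects evens L j = not (isOdd j)
selects first+odds L j = (j ≡ᵇ 0) ∨ isOdd j
selects evens+last L j = not (isOdd j) ∨ (suc j ≡ᵇ L)

size : Pattern → ℕ → ℕ
size π L = ∑ (λ j → bit (selects π L j)) L

private
  ∑-odd : ∀ u → ∑ (λ j → bit (isOdd j)) (2 * u) ≡ u
  ∑-odd zero = refl
  ∑-odd (suc u) = begin
    ∑ (λ j → bit (isOdd j)) (2 * suc u)                          ≡⟨ cong (∑ _) (2*-suc u) ⟩
    ∑ (λ j → bit (isOdd j)) (2 * u) + bit (isOdd (2 * u)) + bit (isOdd (suc (2 * u)))
      ≡⟨ cong₂ (λ a b → a + bit b + bit (isOdd (suc (2 * u)))) (∑-odd u) (isOdd-2* u) ⟩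
    u + 0 + bit (isOdd (suc (2 * u)))                             ≡⟨ cong (λ b → u + 0 + bit b) (isOdd-1+2* u) ⟩
    u + 0 + 1                                                     ≡⟨ cong (_+ 1) (+-identityʳ u) ⟩
    u + 1                                                         ≡⟨ +-comm u 1 ⟩
    suc u                                                         ∎
    where open ≡-Reasoning

  ∑-even : ∀ u → ∑ (λ j → bit (not (isOdd j))) (2 * u) ≡ u
  ∑-even zero = refl
  ∑-even (suc u) = begin
    ∑ (λ j → bit (not (isOdd j))) (2 * suc u)                    ≡⟨ cong (∑ _) (2*-suc u) ⟩
    ∑ (λ j → bit (not (isOdd j))) (2 * u) + bit (not (isOdd (2 * u))) + bit (not (isOdd (suc (2 * u))))
      ≡⟨ cong₂ (λ a b → a + bit (not b) + bit (not (isOdd (suc (2 * u))))) (∑-even u) (isOdd-2* u) ⟩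
    u + 1 + bit (not (isOdd (suc (2 * u))))                       ≡⟨ cong (λ b → u + 1 + bit (not b)) (isOdd-1+2* u) ⟩
    u + 1 + 0                                                     ≡⟨ +-identityʳ (u + 1) ⟩
    u + 1                                                         ≡⟨ +-comm u 1 ⟩
    suc u                                                         ∎
    where open ≡-Reasoning

  size-first+odds-suc : ∀ K → size first+odds (suc K) ≡ suc (∑ (λ j → bit (not (isOdd j))) K)
  size-first+odds-suc K = trans (∑-head _ K) (cong suc (∑-cong K (λ j _ → cong bit (isOdd-suc j))))

  ≡ᵇ-< : ∀ {a b} → a < b → (a ≡ᵇ b) ≡ false
  ≡ᵇ-< {zero} {suc b} _ = refl
  ≡ᵇ-< {suc a} {suc b} (s≤s a<b) = ≡ᵇ-< {a} {b} a<b

  ≡ᵇ-refl : ∀ a → (a ≡ᵇ a) ≡ true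
  ≡ᵇ-refl zero = refl
  ≡ᵇ-refl (suc a) = ≡ᵇ-refl a

  size-evens+last-suc : ∀ K → size evens+last (suc K) ≡ ∑ (λ j → bit (not (isOdd j))) K + 1
  size-evens+last-suc K = cong₂ _+_
    (∑-cong K (λ j j<K → cong bit (trans (cong (not (isOdd j) ∨_) (≡ᵇ-< j<K)) (∨-identityʳ _))))
    (cong bit (trans (cong (not (isOdd K) ∨_) (≡ᵇ-refl K)) (∨-zeroʳ _)))

size-odds-odd : ∀ u → size odds (suc (2 * u)) ≡ u
size-odds-odd u = trans (cong₂ _+_ (∑-odd u) (cong bit (isOdd-2* u))) (+-identityʳ u)

size-odds-even : ∀ u → size odds (suc (suc (2 * u))) ≡ suc u
size-odds-even u = trans (cong (size odds) (sym (2*-suc u))) (∑-odd (suc u))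

size-evens-odd : ∀ u → size evens (suc (2 * u)) ≡ suc u
size-evens-odd u = trans (cong₂ _+_ (∑-even u) (cong (λ b → bit (not b)) (isOdd-2* u))) (+-comm u 1)

size-evens-even : ∀ u → size evens (suc (suc (2 * u))) ≡ suc u
size-evens-even u = trans (cong (size evens) (sym (2*-suc u))) (∑-even (suc u))

size-first+odds-odd : ∀ u → size first+odds (suc (2 * u)) ≡ suc u
size-first+odds-odd u = trans (size-first+odds-suc (2 * u)) (cong suc (∑-even u))

size-first+odds-even : ∀ u → size first+odds (suc (suc (2 * u))) ≡ suc (suc u)
size-first+odds-even u = trans (size-first+odds-suc (suc (2 * u))) (cong suc (size-evens-odd u))

size-evens+last-even : ∀ u → size evens+last (suc (suc (2 * u))) ≡ suc (suc u)
size-evens+last-even u =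
  trans (size-evens+last-suc (suc (2 * u))) (trans (cong (_+ 1) (size-evens-odd u)) (+-comm (suc u) 1))

SelectsEvens SelectsOdds SelectsFirst : Pattern → Set
SelectsEvens π = ∀ L j → isOdd j ≡ false → selects π L j ≡ true
SelectsOdds π = ∀ L j → isOdd j ≡ true → selects π L j ≡ true
SelectsFirst π = ∀ L → selects π L 0 ≡ true

evens-selectsEvens : SelectsEvens evens
evens-selectsEvens L j even = cong not even

evens+last-selectsEvens : SelectsEvens evens+last
evens+last-selectsEvens L j even = cong (λ b → not b ∨ (suc j ≡ᵇ L)) even

odds-selectsOdds : SelectsOdds odds
odds-selectsOdds L j odd = odd

first+odds-selectsOdds : SelectsOdds first+odds
first+odds-selectsOdds L j odd = trans (cong ((j ≡ᵇ 0) ∨_) odd) (∨-zeroʳ _)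

selectsEvens⊎selectsOdds : ∀ π → SelectsEvens π ⊎ SelectsOdds π
selectsEvens⊎selectsOdds odds = inj₂ odds-selectsOdds
selectsEvens⊎selectsOdds evens = inj₁ evens-selectsEvens
selectsEvens⊎selectsOdds first+odds = inj₂ first+odds-selectsOdds
selectsEvens⊎selectsOdds evens+last = inj₁ evens+last-selectsEvens

selects-adjacent : ∀ π L j → selects π L j ≡ true ⊎ selects π L (suc j) ≡ true
selects-adjacent π L j with selectsEvens⊎selectsOdds π | isOdd j in parity
... | inj₁ ev | false = inj₁ (ev L j parity)
... | inj₁ ev | true = inj₂ (ev L (suc j) (trans (isOdd-suc j) (cong not parity)))
... | inj₂ od | true = inj₁ (od L j parity)
... | inj₂ od | false = inj₂ (od L (suc j) (trans (isOdd-suc j) (cong not parity)))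

evens+last-selectsLast : ∀ K → selects evens+last (suc K) K ≡ true
evens+last-selectsLast K = trans (cong (not (isOdd K) ∨_) (≡ᵇ-refl K)) (∨-zeroʳ _)

∣-∣≤⇒ : ∀ a y r → ∣ a - y ∣ ≤ r → a ≤ y + r × y ≤ a + r
∣-∣≤⇒ zero y r h = z≤n , h
∣-∣≤⇒ (suc a) zero r h = h , z≤n
∣-∣≤⇒ (suc a) (suc y) r h with ∣-∣≤⇒ a y r h
... | a≤y+r , y≤a+r = s≤s a≤y+r , s≤s y≤a+r

⇒∣-∣≤ : ∀ a y r → a ≤ y + r → y ≤ a + r → ∣ a - y ∣ ≤ r
⇒∣-∣≤ zero y r _ y≤r = y≤r
⇒∣-∣≤ (suc a) zero r a<r _ = a<r
⇒∣-∣≤ (suc a) (suc y) r (s≤s a≤y+r) (s≤s y≤a+r) = ⇒∣-∣≤ a y r a≤y+r y≤a+r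

near : ℕ → ℕ → ℕ → Bool
near r a y = ⌊ ∣ a - y ∣ ≤? r ⌋

near⇒ : ∀ r a y → near r a y ≡ true → a ≤ y + r × y ≤ a + r
near⇒ r a y h with ∣ a - y ∣ ≤? r
... | yes d≤r = ∣-∣≤⇒ a y r d≤r

⇒near : ∀ r a y → a ≤ y + r → y ≤ a + r → near r a y ≡ true
⇒near r a y a≤y+r y≤a+r with ∣ a - y ∣ ≤? r
... | yes _ = refl
... | no d≰r = ⊥-elim (d≰r (⇒∣-∣≤ a y r a≤y+r y≤a+r))

far⇒ : ∀ r a y → near r a y ≡ false → a ≤ y + r → y ≤ a + r → ⊥
far⇒ r a y h a≤y+r y≤a+r with ∣ a - y ∣ ≤? r
... | no d≰r = d≰r (⇒∣-∣≤ a y r a≤y+r y≤a+r)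

⇒far : ∀ r a y → (a ≤ y + r → y ≤ a + r → ⊥) → near r a y ≡ false
⇒far r a y h with ∣ a - y ∣ ≤? r
... | yes d≤r = ⊥-elim (h (proj₁ (∣-∣≤⇒ a y r d≤r)) (proj₂ (∣-∣≤⇒ a y r d≤r)))
... | no _ = refl

near-separates : ∀ r x y → near r x y ≢ near r (suc x) y → y + r ≡ x ⊎ y ≡ suc x + r
near-separates r x y differ with near r x y in nx | near r (suc x) y in nsx
... | true | true = ⊥-elim (differ refl)
... | false | false = ⊥-elim (differ refl)
... | true | false =
  inj₁ (≤-antisym (≮⇒≥ λ y+r<x → far⇒ r (suc x) y nsx y+r<x (≤-trans y≤x+r (n≤1+n _))) x≤y+r)
  where
  x≤y+r = proj₁ (near⇒ r x y nx)
  y≤x+r = proj₂ (near⇒ r x y nx)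
... | false | true =
  inj₂ (≤-antisym y≤1+x+r (≮⇒≥ λ y<1+x+r → far⇒ r x y nx (≤-trans (n≤1+n _) 1+x≤y+r) (≤-pred y<1+x+r)))
  where
  1+x≤y+r = proj₁ (near⇒ r (suc x) y nsx)
  y≤1+x+r = proj₂ (near⇒ r (suc x) y nsx)

lookup-codeSet : ∀ {n} r D (x y : Fin n) → lookup (codeSet r D x) y ≡ near r (toℕ x) (toℕ y) ∧ lookup D y
lookup-codeSet r D x y = trans (lookup-zipWith _∧_ y (ball r x) D) (cong (_∧ lookup D y) (lookup∘tabulate _ y))

-- Subsets of Fin n seen as predicates on ℕ that vanish from n on.
member : ∀ {n} → Subset n → ℕ → Bool
member [] y = false
member (b ∷ D) zero = b
member (b ∷ D) (suc y) = member D y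

member-toℕ : ∀ {n} (D : Subset n) (i : Fin n) → member D (toℕ i) ≡ lookup D i
member-toℕ (b ∷ D) fzero = refl
member-toℕ (b ∷ D) (fsuc i) = member-toℕ D i

∣∣≡∑member : ∀ {n} (D : Subset n) → ∣ D ∣ ≡ ∑ (λ y → bit (member D y)) n
∣∣≡∑member [] = refl
∣∣≡∑member {suc n} (true ∷ D) = trans (cong suc (∣∣≡∑member D)) (sym (∑-head (λ y → bit (member (true ∷ D) y)) n))
∣∣≡∑member {suc n} (false ∷ D) = trans (∣∣≡∑member D) (sym (∑-head (λ y → bit (member (false ∷ D) y)) n))

fromPredicate : ∀ n → (ℕ → Bool) → Subset n
fromPredicate n g = tabulate (λ i → g (toℕ i))

member-fromPredicate : ∀ {n} g y → y < n → member (fromPredicate n g) y ≡ g y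
member-fromPredicate {n} g y y<n = begin
  member (fromPredicate n g) y                       ≡⟨ cong (member (fromPredicate n g)) (sym (toℕ-fromℕ< y<n)) ⟩
  member (fromPredicate n g) (toℕ (fromℕ< y<n))     ≡⟨ member-toℕ (fromPredicate n g) (fromℕ< y<n) ⟩
  lookup (fromPredicate n g) (fromℕ< y<n)           ≡⟨ lookup∘tabulate _ (fromℕ< y<n) ⟩
  g (toℕ (fromℕ< y<n))                              ≡⟨ cong g (toℕ-fromℕ< y<n) ⟩
  g y                                               ∎
  where open ≡-Reasoning

∣fromPredicate∣ : ∀ n g → ∣ fromPredicate n g ∣ ≡ ∑ (λ y → bit (g y)) n
∣fromPredicate∣ n g = trans (∣∣≡∑member (fromPredicate n g))
                            (∑-cong n (λ y y<n → cong bit (member-fromPredicate g y y<n)))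

SeparatesAdjacent : ℕ → ℕ → (ℕ → Bool) → Set
SeparatesAdjacent r n g =
  ∀ x → suc x < n → Σ ℕ λ y → y < n × g y ≡ true × (y + r ≡ x ⊎ y ≡ suc x + r)

Dominates : ℕ → ℕ → (ℕ → Bool) → Set
Dominates r n g = ∀ x → x < n → Σ ℕ λ y → y < n × g y ≡ true × x ≤ y + r × y ≤ x + r

toFin : ∀ {n} a → a < n → Σ (Fin n) λ i → toℕ i ≡ a
toFin a a<n = fromℕ< a<n , toℕ-fromℕ< a<n

module _ {r n : ℕ} {D : Subset n} (ic : IsIdCode r n D) where

  idCode⇒dominates : Dominates r n (member D)
  idCode⇒dominates x x<n with proj₁ ic (fromℕ< x<n)
  ... | w , w∈code = toℕ w , toℕ<n w , trans (member-toℕ D w) (Bool.∧-conicalʳ _ _ near∧∈D) ,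
        subst (λ a → a ≤ toℕ w + r × toℕ w ≤ a + r) (toℕ-fromℕ< x<n)
              (near⇒ r _ (toℕ w) (Bool.∧-conicalˡ _ _ near∧∈D))
    where
    near∧∈D : near r (toℕ (fromℕ< x<n)) (toℕ w) ∧ lookup D w ≡ true
    near∧∈D = trans (sym (lookup-codeSet r D (fromℕ< x<n) w)) ([]=⇒lookup w∈code)

  idCode⇒separatesAdjacent : SeparatesAdjacent r n (member D)
  idCode⇒separatesAdjacent x 1+x<n with toFin x (<-trans (n<1+n x) 1+x<n) | toFin (suc x) 1+x<n
  ... | i , refl | j , j≡1+i
    with ¬∀⟶∃¬ n (λ w → lookup (codeSet r D i) w ≡ lookup (codeSet r D j) w)
                 (λ w → lookup (codeSet r D i) w Bool.≟ lookup (codeSet r D j) w)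
                 (λ same → proj₂ ic i j (λ i≡j → 1+n≢n (trans (sym j≡1+i) (cong toℕ (sym i≡j))))
                                        (lookup-ext same))
    where
    lookup-ext : ∀ {u v : Subset n} → (∀ w → lookup u w ≡ lookup v w) → u ≡ v
    lookup-ext {u} {v} same = trans (sym (tabulate∘lookup u)) (trans (tabulate-cong same) (tabulate∘lookup v))
  ... | w , differ with lookup D w in w∈D
  ...   | false = ⊥-elim (differ (trans (outside i) (sym (outside j))))
    where
    outside : ∀ k → lookup (codeSet r D k) w ≡ false
    outside k = trans (lookup-codeSet r D k w) (trans (cong (_ ∧_) w∈D) (Bool.∧-zeroʳ _))
  ...   | true = toℕ w , toℕ<n w , trans (member-toℕ D w) w∈D ,
                 near-separates r (toℕ i) (toℕ w)
                   (λ same → differ (trans (inside i) (trans same (sym (trans (inside j)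
                                                                        (cong (λ a → near r a (toℕ w)) j≡1+i))))))
    where
    inside : ∀ k → lookup (codeSet r D k) w ≡ near r (toℕ k) (toℕ w)
    inside k = trans (lookup-codeSet r D k w) (trans (cong (_ ∧_) w∈D) (Bool.∧-identityʳ _))

module _ {r n : ℕ} {g : ℕ → Bool} (separates : SeparatesAdjacent r n g) (dominates : Dominates r n g) where

  private
    D = fromPredicate n g

    code-member : ∀ (x : Fin n) {w} (w<n : w < n) → lookup (codeSet r D x) (fromℕ< w<n) ≡ near r (toℕ x) w ∧ g w
    code-member x {w} w<n = begin
      lookup (codeSet r D x) (fromℕ< w<n)                                   ≡⟨ lookup-codeSet r D x (fromℕ< w<n) ⟩
      near r (toℕ x) (toℕ (fromℕ< w<n)) ∧ lookup D (fromℕ< w<n)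
        ≡⟨ cong₂ (λ a b → near r (toℕ x) a ∧ b) (toℕ-fromℕ< w<n)
                 (trans (sym (member-toℕ D (fromℕ< w<n))) (member-fromPredicate g _ (toℕ<n (fromℕ< w<n)))) ⟩
      near r (toℕ x) w ∧ g (toℕ (fromℕ< w<n))
        ≡⟨ cong (λ a → near r (toℕ x) w ∧ g a) (toℕ-fromℕ< w<n) ⟩
      near r (toℕ x) w ∧ g w                                                ∎
      where open ≡-Reasoning

    distinguishes : ∀ (x y : Fin n) w → w < n → g w ≡ true → near r (toℕ x) w ≡ true → near r (toℕ y) w ≡ false →
                    codeSet r D x ≢ codeSet r D y
    distinguishes x y w w<n gw near-x far-y same = true≢false (begin
      true                                    ≡⟨ sym (cong₂ _∧_ near-x gw) ⟩
      near r (toℕ x) w ∧ g w                  ≡⟨ sym (code-member x w<n) ⟩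
      lookup (codeSet r D x) (fromℕ< w<n)     ≡⟨ cong (λ c → lookup c (fromℕ< w<n)) same ⟩
      lookup (codeSet r D y) (fromℕ< w<n)     ≡⟨ code-member y w<n ⟩
      near r (toℕ y) w ∧ g w                  ≡⟨ cong (_∧ g w) far-y ⟩
      false                                   ∎)
      where
      open ≡-Reasoning
      true≢false : true ≢ false
      true≢false ()

    -- x < y are told apart by the vertex separating x from x + 1, unless that vertex lies
    -- beyond y + r; then any vertex dominating y does.
    distinct-< : ∀ (x y : Fin n) → toℕ x < toℕ y → codeSet r D x ≢ codeSet r D y
    distinct-< x y x<y with separates (toℕ x) (<-≤-trans (s≤s x<y) (toℕ<n y))
    ... | w , w<n , gw , inj₁ w+r≡x =
      distinguishes x y w w<n gw
        (⇒near r (toℕ x) w (≤-reflexive (sym w+r≡x)) (≤-trans (m≤m+n w r) (≤-trans (≤-reflexive w+r≡x) (m≤m+n _ r))))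
        (⇒far r (toℕ y) w λ y≤w+r _ → <⇒≱ x<y (≤-trans y≤w+r (≤-reflexive w+r≡x)))
    ... | w , w<n , gw , inj₂ w≡1+x+r with toℕ y ≤? w + r
    ...   | yes y≤w+r = λ same → distinguishes y x w w<n gw
              (⇒near r (toℕ y) w y≤w+r (≤-trans (≤-reflexive w≡1+x+r) (+-monoˡ-≤ r x<y)))
              (⇒far r (toℕ x) w λ _ w≤x+r → 1+n≰n (≤-trans (≤-reflexive (sym w≡1+x+r)) w≤x+r))
              (sym same)
    ...   | no y≰w+r with dominates (toℕ y) (toℕ<n y)
    ...     | z , z<n , gz , y≤z+r , z≤y+r = λ same → distinguishes y x z z<n gz
              (⇒near r (toℕ y) z y≤z+r z≤y+r)
              (⇒far r (toℕ x) z λ _ z≤x+r → y≰w+r (≤-trans y≤z+r (+-monoˡ-≤ r (≤-trans z≤x+r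
                 (≤-trans (n≤1+n _) (≤-reflexive (sym w≡1+x+r)))))))
              (sym same)

  separates∧dominates⇒idCode : IsIdCode r n (fromPredicate n g)
  separates∧dominates⇒idCode = nonempty , distinct
    where
    nonempty : ∀ x → Nonempty (codeSet r D x)
    nonempty x with dominates (toℕ x) (toℕ<n x)
    ... | y , y<n , gy , x≤y+r , y≤x+r =
      fromℕ< y<n , lookup⇒[]= (fromℕ< y<n) (codeSet r D x)
                     (trans (code-member x y<n) (cong₂ _∧_ (⇒near r (toℕ x) y x≤y+r y≤x+r) gy))
    distinct : ∀ x y → x ≢ y → codeSet r D x ≢ codeSet r D y
    distinct x y x≢y with <-cmp (toℕ x) (toℕ y)
    ... | tri< x<y _ _ = distinct-< x y x<y
    ... | tri≈ _ x≡y _ = ⊥-elim (x≢y (toℕ-injective x≡y))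
    ... | tri> _ _ y<x = λ same → distinct-< y x y<x (sym same)

-- On P_(n' + 2r + 1): a pair x, x + 1 away from the ends is separated by x - r or x + r + 1,
-- which are 2r + 1 apart; the pairs at the ends need r + 1 + i and n' + i for i < r.
module _ {r n' : ℕ} {g : ℕ → Bool}
         (periodic : ∀ v → g v ≡ true ⊎ g (v + suc (r + r)) ≡ true)
         (left : ∀ i → i < r → g (suc r + i) ≡ true)
         (right : ∀ i → i < r → g (n' + i) ≡ true)
         where

  private
    m = suc (r + r)
    n = n' + m

    x∸r+m : ∀ {x} → r ≤ x → x ∸ r + m ≡ suc x + r
    x∸r+m {x} r≤x = trans (shift (x ∸ r) r) (cong (λ z → suc z + r) (m∸n+n≡m r≤x))
      where
      shift : ∀ a r → a + suc (r + r) ≡ suc (a + r) + r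
      shift = solve-∀

  separatesAdjacent-from-blocks : SeparatesAdjacent r n g
  separatesAdjacent-from-blocks x 1+x<n with x <? r
  ... | yes x<r = suc x + r , <-≤-trans (s≤s (+-monoˡ-< r x<r)) (m≤n+m m n') ,
                  subst (λ z → g z ≡ true) (trans (+-comm (suc r) x) (+-suc x r)) (left x x<r) , inj₂ refl
  ... | no x≮r with suc x + r <? n
  ...   | yes 1+x+r<n with periodic (x ∸ r)
  ...     | inj₁ g[x∸r] = x ∸ r , ≤-<-trans (m∸n≤m x r) (<-trans (n<1+n x) 1+x<n) , g[x∸r] ,
                          inj₁ (m∸n+n≡m (≮⇒≥ x≮r))
  ...     | inj₂ g[x∸r+m] = x ∸ r + m , subst (_< n) (sym (x∸r+m (≮⇒≥ x≮r))) 1+x+r<n , g[x∸r+m] ,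
                            inj₂ (x∸r+m (≮⇒≥ x≮r))
  separatesAdjacent-from-blocks x 1+x<n | no x≮r | no 1+x+r≮n =
    x ∸ r , ≤-<-trans (m∸n≤m x r) (<-trans (n<1+n x) 1+x<n) ,
    subst (λ z → g z ≡ true) n'+i≡x∸r (right i i<r) , inj₁ (m∸n+n≡m r≤x)
    where
    r≤x = ≮⇒≥ x≮r
    i = x ∸ r ∸ n'
    n'≤x∸r : n' ≤ x ∸ r
    n'≤x∸r = +-cancelʳ-≤ m n' (x ∸ r) (≤-trans (≮⇒≥ 1+x+r≮n) (≤-reflexive (sym (x∸r+m r≤x))))
    n'+i≡x∸r : n' + i ≡ x ∸ r
    n'+i≡x∸r = m+[n∸m]≡n n'≤x∸r
    i<r : i < r
    i<r = +-cancelˡ-< n' i r (subst (_< n' + r) (sym n'+i≡x∸r)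
            (+-cancelʳ-< (suc r) (x ∸ r) (n' + r) (subst₂ _<_ (sym x∸r+1+r) (regroup n' r) 1+x<n)))
      where
      x∸r+1+r : x ∸ r + suc r ≡ suc x
      x∸r+1+r = trans (+-suc (x ∸ r) r) (cong suc (m∸n+n≡m r≤x))
      regroup : ∀ n' r → n' + suc (r + r) ≡ (n' + r) + suc r
      regroup = solve-∀

  module _ (start : Σ ℕ λ y → y ≤ r × g y ≡ true)
           (end : Σ ℕ λ y → y < n × n ≤ suc (y + r) × g y ≡ true)
           (window : ∀ a → a + m ≤ n → Σ ℕ λ y → a ≤ y × y < a + m × g y ≡ true)
           where

    dominates-from-windows : Dominates r n g
    dominates-from-windows x x<n with x ≤? r
    ... | yes x≤r = let y , y≤r , gy = start in y , ≤-<-trans y≤r (<-≤-trans (s≤s (m≤m+n r r)) (m≤n+m m n')) , gy ,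
                           ≤-trans x≤r (m≤n+m r y) , ≤-trans y≤r (m≤n+m r x)
    dominates-from-windows x x<n | no x≰r with n ≤? suc (x + r)
    ... | yes n≤1+x+r = let y , y<n , n≤1+y+r , gy = end in y , y<n , gy ,
                        ≤-pred (<-≤-trans x<n n≤1+y+r) , ≤-pred (<-≤-trans y<n n≤1+x+r)
    ... | no n≰1+x+r with window (x ∸ r) (≤-trans (≤-reflexive (x∸r+m (≰⇒≥ x≰r))) (<⇒≤ (≰⇒> n≰1+x+r)))
    ...   | y , x∸r≤y , y<x∸r+m , gy =
      y , <-≤-trans y<x∸r+m (≤-trans (≤-reflexive (x∸r+m (≰⇒≥ x≰r))) (<⇒≤ (≰⇒> n≰1+x+r))) , gy ,
      ≤-trans (≤-reflexive (sym (m∸n+n≡m (≰⇒≥ x≰r)))) (+-monoˡ-≤ r x∸r≤y) ,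
      ≤-pred (<-≤-trans y<x∸r+m (≤-reflexive (x∸r+m (≰⇒≥ x≰r))))

-- Residue classes modulo 2r + 1

-- P_n with n = (p' + 1)(2r + 1) + q, split into the residue classes c < m = 2r + 1 of its
-- vertices modulo m; class c is the chain c, c + m, c + 2m, … of length L c.
module ResidueClasses (r p' q : ℕ) (q<m : q < suc (r + r)) where

  m = suc (r + r)
  p = suc p'
  n' = p' * m + q
  n = n' + m

  L : ℕ → ℕ
  L c = classSize p q c

  last : ℕ → ℕ
  last c = c + pred (L c) * m

  n≡p*m+q : n ≡ p * m + q
  n≡p*m+q = regroup p' m q
    where
    regroup : ∀ p' m q → p' * m + q + m ≡ suc p' * m + q
    regroup = solve-∀

  L-< : ∀ {c} → c < q → L c ≡ suc p
  L-< c<q = trans (cong (p +_) (ifBelow-< c<q)) (+-comm p 1)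

  L-≥ : ∀ {c} → q ≤ c → L c ≡ p
  L-≥ q≤c = trans (cong (p +_) (ifBelow-≥ q≤c)) (+-identityʳ p)

  r<m : r < m
  r<m = s≤s (m≤m+n r r)

  r+r<m : r + r < m
  r+r<m = n<1+n (r + r)

  -- the last vertex of class c is one of the vertices n', …, n' + r - 1 forced at the right end
  EndsRightForced : ℕ → Set
  EndsRightForced c = (q ≤ c × c < q + r) ⊎ (c + m < q + r)

  last-≥ : ∀ {c} → q ≤ c → last c ≡ n' + (c ∸ q)
  last-≥ {c} q≤c = begin
    c + pred (L c) * m        ≡⟨ cong (λ l → c + pred l * m) (L-≥ q≤c) ⟩
    c + p' * m                ≡⟨ cong (_+ p' * m) (sym (m+[n∸m]≡n q≤c)) ⟩
    q + (c ∸ q) + p' * m      ≡⟨ rotate q (c ∸ q) (p' * m) ⟩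
    p' * m + q + (c ∸ q)      ∎
    where
    open ≡-Reasoning
    rotate : ∀ a b c → a + b + c ≡ c + a + b
    rotate = solve-∀

  last-< : ∀ {c} → c < q → last c ≡ n' + (c + m ∸ q)
  last-< {c} c<q = begin
    c + pred (L c) * m        ≡⟨ cong (λ l → c + pred l * m) (L-< c<q) ⟩
    c + p * m                 ≡⟨ shift c m (p' * m) ⟩
    c + m + p' * m            ≡⟨ cong (_+ p' * m) (sym (m+[n∸m]≡n q≤c+m)) ⟩
    q + (c + m ∸ q) + p' * m  ≡⟨ rotate q (c + m ∸ q) (p' * m) ⟩
    p' * m + q + (c + m ∸ q)  ∎
    where
    open ≡-Reasoning
    q≤c+m = ≤-trans (<⇒≤ q<m) (m≤n+m m c)
    shift : ∀ c m k → c + (m + k) ≡ c + m + k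
    shift = solve-∀
    rotate : ∀ a b c → a + b + c ≡ c + a + b
    rotate = solve-∀

  rightForced-last : ∀ {c} → EndsRightForced c → Σ ℕ λ i → i < r × n' + i ≡ last c
  rightForced-last {c} (inj₁ (q≤c , c<q+r)) =
    c ∸ q , +-cancelˡ-< q _ _ (subst (_< q + r) (sym (m+[n∸m]≡n q≤c)) c<q+r) , sym (last-≥ q≤c)
  rightForced-last {c} (inj₂ c+m<q+r) =
    c + m ∸ q , +-cancelˡ-< q _ _ (subst (_< q + r) (sym (m+[n∸m]≡n q≤c+m)) c+m<q+r) , sym (last-< c<q)
    where
    q≤c+m = ≤-trans (<⇒≤ q<m) (m≤n+m m c)
    c<q = +-cancelʳ-< m c q (<-≤-trans c+m<q+r (+-monoʳ-≤ q (<⇒≤ r<m)))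

  member-class : ∀ {c j} → c < m → j < L c → c + j * m < n
  member-class {c} {j} c<m j<L with q ≤? c
  ... | no q≰c = begin-strict
    c + j * m          <⟨ +-monoˡ-< (j * m) (≰⇒> q≰c) ⟩
    q + j * m          ≤⟨ +-monoʳ-≤ q (*-monoˡ-≤ m (≤-pred (subst (j <_) (L-< (≰⇒> q≰c)) j<L))) ⟩
    q + p * m          ≡⟨ +-comm q (p * m) ⟩
    p * m + q          ≡⟨ sym n≡p*m+q ⟩
    n                  ∎
    where open ≤-Reasoning
  ... | yes q≤c = begin-strict
    c + j * m          <⟨ +-monoˡ-< (j * m) c<m ⟩
    m + j * m          ≤⟨ +-monoʳ-≤ m (*-monoˡ-≤ m (≤-pred (subst (j <_) (L-≥ q≤c) j<L))) ⟩
    p * m              ≤⟨ m≤m+n (p * m) q ⟩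
    p * m + q          ≡⟨ sym n≡p*m+q ⟩
    n                  ∎
    where open ≤-Reasoning

  module LowerBound (D : Subset n) (ic : IsIdCode r n D) where

    d : ℕ → ℕ
    d y = bit (member D y)

    S : ℕ → ℕ
    S c = classSum d m p q c

    ∣D∣≡∑S : ∣ D ∣ ≡ ∑ S m
    ∣D∣≡∑S = trans (∣∣≡∑member D) (trans (cong (∑ d) n≡p*m+q) (∑-byClass d m p q (<⇒≤ q<m)))

    private
      separated : ∀ x → suc x < n → Σ ℕ λ y → y < n × d y ≡ 1 × (y + r ≡ x ⊎ y ≡ suc x + r)
      separated x 1+x<n with idCode⇒separatesAdjacent ic x 1+x<n
      ... | y , y<n , y∈D , y-separates = y , y<n , cong bit y∈D , y-separates

      dominated : ∀ x → x < n → Σ ℕ λ y → y < n × d y ≡ 1 × x ≤ y + r × y ≤ x + r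
      dominated x x<n with idCode⇒dominates ic x x<n
      ... | y , y<n , y∈D , x≤y+r , y≤x+r = y , y<n , cong bit y∈D , x≤y+r , y≤x+r

    no-gap : ∀ v → v + m < n → d v ≡ 1 ⊎ d (v + m) ≡ 1
    no-gap v v+m<n with separated (v + r) (≤-<-trans (≤-trans (≤-reflexive (sym (+-suc v r)))
                                                              (+-monoʳ-≤ v (s≤s (m≤m+n r r)))) v+m<n)
    ... | y , _ , dy , inj₁ y+r≡v+r = inj₁ (subst (λ z → d z ≡ 1) (+-cancelʳ-≡ r y v y+r≡v+r) dy)
    ... | y , _ , dy , inj₂ y≡1+v+r+r = inj₂ (subst (λ z → d z ≡ 1) (trans y≡1+v+r+r (regroup v r)) dy)
      where
      regroup : ∀ v r → suc (v + r) + r ≡ v + suc (r + r)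
      regroup = solve-∀

    private
      leftForced : ∀ i → i < r → d (suc r + i) ≡ 1
      leftForced i i<r with separated i (≤-<-trans i<r (<-≤-trans r<m (m≤n+m m n')))
      ... | y , _ , _ , inj₁ y+r≡i = ⊥-elim (<⇒≱ i<r (≤-trans (m≤n+m r y) (≤-reflexive y+r≡i)))
      ... | y , _ , dy , inj₂ y≡1+i+r = subst (λ z → d z ≡ 1) (trans y≡1+i+r (cong suc (+-comm i r))) dy

      rightForced : ∀ i → i < r → d (n' + i) ≡ 1
      rightForced i i<r
        with separated (n' + i + r) (subst (_< n) (+-suc-suc n' i r) (+-monoʳ-< n' (s≤s (+-monoˡ-< r i<r))))
        where
        +-suc-suc : ∀ n' i r → n' + suc (i + r) ≡ suc (n' + i + r)
        +-suc-suc = solve-∀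
      ... | y , _ , dy , inj₁ y+r≡n'+i+r = subst (λ z → d z ≡ 1) (+-cancelʳ-≡ r y (n' + i) y+r≡n'+i+r) dy
      ... | y , y<n , _ , inj₂ y≡1+n'+i+r+r = ⊥-elim (<⇒≱ y<n (begin
        n' + suc (r + r)         ≤⟨ +-monoʳ-≤ n' (s≤s (+-monoˡ-≤ r (m≤n+m r i))) ⟩
        n' + suc (i + r + r)     ≡⟨ regroup n' i r ⟩
        suc (n' + i + r) + r     ≡⟨ sym y≡1+n'+i+r+r ⟩
        y                        ∎))
        where
        open ≤-Reasoning
        regroup : ∀ n' i r → n' + suc (i + r + r) ≡ suc (n' + i + r) + r
        regroup = solve-∀

    first-forced : ∀ c → suc r ≤ c → c < m → d c ≡ 1
    first-forced c r<c c<m = subst (λ z → d z ≡ 1) (m+[n∸m]≡n r<c)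
      (leftForced (c ∸ suc r) (+-cancelˡ-< (suc r) _ _ (subst (_< suc r + r) (sym (m+[n∸m]≡n r<c)) c<m)))

    last-forced : ∀ c → EndsRightForced c → d (last c) ≡ 1
    last-forced c ends with rightForced-last ends
    ... | i , i<r , n'+i≡last = subst (λ z → d z ≡ 1) n'+i≡last (rightForced i i<r)

    ∑≤∣D∣ : ∀ β → (∀ c → c < m → β c ≤ S c) → ∑ β m ≤ ∣ D ∣
    ∑≤∣D∣ β β≤S = ≤-trans (∑-mono m β≤S) (≤-reflexive (sym ∣D∣≡∑S))

    class-bound : ∀ c → c < m → L c + d c + d (last c) ≤ 2 * S c + 1
    class-bound c c<m = subst (λ z → L c + d z + d (last c) ≤ 2 * S c + 1) (+-identityʳ c)
      (chain-bound (λ j → d (c + j * m)) (pred (L c)) adjacent)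
      where
      next : ∀ j → c + j * m + m ≡ c + suc j * m
      next j = trans (+-assoc c (j * m) m) (cong (c +_) (+-comm (j * m) m))
      adjacent : ∀ j → suc j < L c → 1 ≤ d (c + j * m) + d (c + suc j * m)
      adjacent j 1+j<L with no-gap (c + j * m) (subst (_< n) (sym (next j)) (member-class c<m 1+j<L))
      ... | inj₁ dj≡1 = ≤-trans (≤-reflexive (sym dj≡1)) (m≤m+n _ _)
      ... | inj₂ dj+1≡1 = ≤-trans (≤-reflexive (sym (trans (cong d (sym (next j))) dj+1≡1))) (m≤n+m _ _)

    near-start : Σ ℕ λ y → y ≤ r × d y ≡ 1
    near-start with dominated 0 (<-≤-trans (s≤s z≤n) (m≤n+m m n'))
    ... | y , _ , dy , _ , y≤r = y , y≤r , dy

    near-end : Σ ℕ λ i → r ≤ i × i < m × d (n' + i) ≡ 1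
    near-end with dominated (n' + (r + r)) (+-monoʳ-< n' (n<1+n (r + r)))
    ... | y , y<n , dy , n'+r+r≤y+r , _ =
      y ∸ n' , r≤i , +-cancelˡ-< n' _ _ (subst (_< n) (sym n'+i≡y) y<n) , subst (λ z → d z ≡ 1) (sym n'+i≡y) dy
      where
      n'+r≤y : n' + r ≤ y
      n'+r≤y = +-cancelʳ-≤ r _ _ (≤-trans (≤-reflexive (+-assoc n' r r)) n'+r+r≤y+r)
      n'+i≡y : n' + (y ∸ n') ≡ y
      n'+i≡y = m+[n∸m]≡n (≤-trans (m≤m+n n' r) n'+r≤y)
      r≤i : r ≤ y ∸ n'
      r≤i = +-cancelˡ-≤ n' _ _ (≤-trans n'+r≤y (≤-reflexive (sym n'+i≡y)))

  class-at : ∀ i → i < m → Σ ℕ λ c → c < m × (q + i ≡ c ⊎ q + i ≡ c + m)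
  class-at i i<m with q + i <? m
  ... | yes q+i<m = q + i , q+i<m , inj₁ refl
  ... | no q+i≮m = q + i ∸ m , +-cancelʳ-< m _ _ (subst (_< m + m) (sym (m∸n+n≡m (≮⇒≥ q+i≮m))) (+-mono-< q<m i<m)) ,
                   inj₂ (sym (m∸n+n≡m (≮⇒≥ q+i≮m)))

  last-at : ∀ {c i} → i < m → (q + i ≡ c ⊎ q + i ≡ c + m) → last c ≡ n' + i
  last-at {c} {i} _ (inj₁ refl) = trans (last-≥ (m≤m+n q i)) (cong (n' +_) (m+n∸m≡n q i))
  last-at {c} {i} i<m (inj₂ q+i≡c+m) =
    trans (last-< c<q) (cong (n' +_) (trans (cong (_∸ q) (sym q+i≡c+m)) (m+n∸m≡n q i)))
    where
    c<q : c < q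
    c<q = +-cancelʳ-< m c q (subst (_< q + m) q+i≡c+m (+-monoʳ-< q i<m))

  module Design (T : ℕ → Pattern) where

    g : ℕ → Bool
    g v = selects (T (v % m)) (L (v % m)) (v / m)

    g-class : ∀ {c} j → c < m → g (c + j * m) ≡ selects (T c) (L c) j
    g-class {c} j c<m = cong₂ (λ c′ j′ → selects (T c′) (L c′) j′) residue quotient
      where
      residue : (c + j * m) % m ≡ c
      residue = trans ([m+kn]%n≡m%n c j m) (m<n⇒m%n≡m c<m)
      quotient : (c + j * m) / m ≡ j
      quotient = trans (+-distrib-/-∣ʳ c (divides-refl j)) (cong₂ _+_ (m<n⇒m/n≡0 c<m) (m*n/n≡m j m))

    ∣code∣≡∑size : ∣ fromPredicate n g ∣ ≡ ∑ (λ c → size (T c) (L c)) m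
    ∣code∣≡∑size = begin
      ∣ fromPredicate n g ∣                   ≡⟨ ∣fromPredicate∣ n g ⟩
      ∑ (λ v → bit (g v)) n                    ≡⟨ cong (∑ _) n≡p*m+q ⟩
      ∑ (λ v → bit (g v)) (p * m + q)          ≡⟨ ∑-byClass (λ v → bit (g v)) m p q (<⇒≤ q<m) ⟩
      ∑ (classSum (λ v → bit (g v)) m p q) m
        ≡⟨ ∑-cong m (λ c c<m → ∑-cong (L c) (λ j _ → cong bit (g-class j c<m))) ⟩
      ∑ (λ c → size (T c) (L c)) m            ∎
      where open ≡-Reasoning

    SelectsLast : ℕ → Set
    SelectsLast c = selects (T c) (L c) (pred (L c)) ≡ true

    Alternating : ℕ → ℕ → ℕ → Set
    Alternating c₁ c₂ c₃ = (SelectsEvens (T c₁) × SelectsOdds (T c₂) × SelectsEvens (T c₃))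
                         ⊎ (SelectsOdds (T c₁) × SelectsEvens (T c₂) × SelectsOdds (T c₃))

    private
      decompose : ∀ v → v % m + (v / m) * m ≡ v
      decompose v = sym (m≡m%n+[m/n]*n v m)

      periodic : ∀ v → g v ≡ true ⊎ g (v + m) ≡ true
      periodic v with selects-adjacent (T (v % m)) (L (v % m)) (v / m)
      ... | inj₁ selected = inj₁ selected
      ... | inj₂ selected = inj₂ (trans (cong g (sym next)) (trans (g-class (suc (v / m)) (m%n<n v m)) selected))
        where
        regroup : ∀ a b m → a + suc b * m ≡ a + b * m + m
        regroup = solve-∀
        next : v % m + suc (v / m) * m ≡ v + m
        next = trans (regroup (v % m) (v / m) m) (cong (_+ m) (decompose v))

      g-last : ∀ {c} → c < m → SelectsLast c → g (last c) ≡ true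
      g-last c<m selected = trans (g-class _ c<m) selected

      g-first : ∀ {c} → c < m → SelectsFirst (T c) → g c ≡ true
      g-first {c} c<m selected = trans (cong g (sym (+-identityʳ c))) (trans (g-class 0 c<m) (selected _))

      Hit : ℕ → Set
      Hit a = Σ ℕ λ y → a ≤ y × y < a + m × g y ≡ true

      hit-at : ∀ a c → c < m → a % m ≤ c → selects (T c) (L c) (a / m) ≡ true → Hit a
      hit-at a c c<m s≤c selected =
        c + k * m ,
        subst (_≤ c + k * m) (decompose a) (+-monoˡ-≤ (k * m) s≤c) ,
        subst (c + k * m <_) (cong (_+ m) (decompose a))
              (<-≤-trans (+-monoˡ-< (k * m) c<m) (≤-trans (≤-reflexive (+-comm m (k * m))) (+-monoˡ-≤ m (m≤n+m (k * m) _)))) ,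
        trans (g-class k c<m) selected
        where
        k = a / m

      hit-after : ∀ a c → c < a % m → selects (T c) (L c) (suc (a / m)) ≡ true → Hit a
      hit-after a c c<s selected =
        c + suc k * m ,
        subst (_≤ c + suc k * m) (decompose a)
              (≤-trans (<⇒≤ (+-monoˡ-< (k * m) (m%n<n a m))) (≤-trans (+-monoˡ-≤ (k * m) (m≤n+m m c)) (≤-reflexive (lift c k m)))) ,
        subst (c + suc k * m <_) (cong (_+ m) (decompose a))
              (subst₂ _<_ (sym (shift c k m)) (sym (+-assoc (a % m) (k * m) m)) (+-monoˡ-< (k * m + m) c<s)) ,
        trans (g-class (suc k) (<-trans c<s (m%n<n a m))) selected
        where
        k = a / m
        lift : ∀ c k m → c + m + k * m ≡ c + suc k * m
        lift = solve-∀
        shift : ∀ c k m → c + suc k * m ≡ c + (k * m + m)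
        shift = solve-∀

      -- Writing a = s + k m, the window [a, a + m) meets class c at index k if s ≤ c and at
      -- index k + 1 otherwise; by alternation one of these indices is selected for either parity of k.
      window : ∀ {c₁ c₂ c₃} → c₁ < c₂ → c₂ < c₃ → c₃ < m → Alternating c₁ c₂ c₃ → ∀ a → Hit a
      window {c₁} {c₂} {c₃} c₁<c₂ c₂<c₃ c₃<m alternating a = go alternating
        where
        s = a % m
        k = a / m
        c₂<m = <-trans c₂<c₃ c₃<m
        c₁<m = <-trans c₁<c₂ c₂<m
        flip : ∀ b → isOdd k ≡ b → isOdd (suc k) ≡ not b
        flip b parity = trans (isOdd-suc k) (cong not parity)
        go : Alternating c₁ c₂ c₃ → Hit a
        go (inj₁ (ev₁ , od₂ , ev₃)) with isOdd k in parity
        ... | false with s ≤? c₁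
        ...   | yes s≤c₁ = hit-at a c₁ c₁<m s≤c₁ (ev₁ _ k parity)
        ...   | no s≰c₁ with s ≤? c₃
        ...     | yes s≤c₃ = hit-at a c₃ c₃<m s≤c₃ (ev₃ _ k parity)
        ...     | no s≰c₃ = hit-after a c₂ (<-trans c₂<c₃ (≰⇒> s≰c₃)) (od₂ _ (suc k) (flip false parity))
        go (inj₁ (ev₁ , od₂ , ev₃)) | true with s ≤? c₂
        ...   | yes s≤c₂ = hit-at a c₂ c₂<m s≤c₂ (od₂ _ k parity)
        ...   | no s≰c₂ = hit-after a c₁ (<-trans c₁<c₂ (≰⇒> s≰c₂)) (ev₁ _ (suc k) (flip true parity))
        go (inj₂ (od₁ , ev₂ , od₃)) with isOdd k in parity
        ... | true with s ≤? c₁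
        ...   | yes s≤c₁ = hit-at a c₁ c₁<m s≤c₁ (od₁ _ k parity)
        ...   | no s≰c₁ with s ≤? c₃
        ...     | yes s≤c₃ = hit-at a c₃ c₃<m s≤c₃ (od₃ _ k parity)
        ...     | no s≰c₃ = hit-after a c₂ (<-trans c₂<c₃ (≰⇒> s≰c₃)) (ev₂ _ (suc k) (flip true parity))
        go (inj₂ (od₁ , ev₂ , od₃)) | false with s ≤? c₂
        ...   | yes s≤c₂ = hit-at a c₂ c₂<m s≤c₂ (ev₂ _ k parity)
        ...   | no s≰c₂ = hit-after a c₁ (<-trans c₁<c₂ (≰⇒> s≰c₂)) (od₁ _ (suc k) (flip false parity))

    selectsFirst : ∀ c {π} → T c ≡ π → SelectsFirst π → SelectsFirst (T c)
    selectsFirst c Tc≡π first = subst SelectsFirst (sym Tc≡π) first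

    selectsLast-even : ∀ c {π} u → L c ≡ suc (suc (2 * u)) → T c ≡ π → SelectsOdds π → SelectsLast c
    selectsLast-even c u Lc≡ Tc≡π odd = subst₂ (λ l π′ → selects π′ l (pred l) ≡ true) (sym Lc≡) (sym Tc≡π)
                                                   (odd _ (suc (2 * u)) (isOdd-1+2* u))

    selectsLast-odd : ∀ c {π} u → L c ≡ suc (2 * u) → T c ≡ π → SelectsEvens π → SelectsLast c
    selectsLast-odd c u Lc≡ Tc≡π even = subst₂ (λ l π′ → selects π′ l (pred l) ≡ true) (sym Lc≡) (sym Tc≡π)
                                                   (even _ (2 * u) (isOdd-2* u))

    selectsLast-evens+last : ∀ c → T c ≡ evens+last → SelectsLast c
    selectsLast-evens+last c Tc≡ = subst (λ π → selects π (L c) (pred (L c)) ≡ true) (sym Tc≡)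
                                           (evens+last-selectsLast (pred (L c)))

    design : (β : ℕ → ℕ) → (∀ c → c < m → size (T c) (L c) ≡ β c) →
             (∀ c → suc r ≤ c → c < m → SelectsFirst (T c)) →
             (∀ c → c < m → EndsRightForced c → SelectsLast c) →
             (Σ ℕ λ c → c ≤ r × SelectsFirst (T c)) →
             (Σ ℕ λ c → Σ ℕ λ i → c < m × r ≤ i × i < m × (q + i ≡ c ⊎ q + i ≡ c + m) × SelectsLast c) →
             (Σ ℕ λ c₁ → Σ ℕ λ c₂ → Σ ℕ λ c₃ → c₁ < c₂ × c₂ < c₃ × c₃ < m × Alternating c₁ c₂ c₃) →
             Σ (Subset n) λ D → IsIdCode r n D × ∣ D ∣ ≡ ∑ β m
    design β sizes firsts lasts (c , c≤r , first) (cₑ , i , cₑ<m , r≤i , i<m , at , last)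
           (c₁ , c₂ , c₃ , c₁<c₂ , c₂<c₃ , c₃<m , alt) =
      fromPredicate n g ,
      separates∧dominates⇒idCode
        (separatesAdjacent-from-blocks periodic left right)
        (dominates-from-windows periodic left right
          (c , c≤r , g-first (≤-<-trans c≤r r<m) first)
          (n' + i , +-monoʳ-< n' i<m , n≤ , trans (cong g (sym (last-at i<m at))) (g-last cₑ<m last))
          (λ a _ → window c₁<c₂ c₂<c₃ c₃<m alt a)) ,
      trans ∣code∣≡∑size (∑-cong m sizes)
      where
      left : ∀ i → i < r → g (suc r + i) ≡ true
      left i i<r = g-first c<m (firsts (suc r + i) (m≤m+n (suc r) i) c<m)
        where
        c<m = s≤s (+-monoʳ-< r i<r)
      right : ∀ i → i < r → g (n' + i) ≡ true
      right i i<r with class-at i (<-trans i<r r<m)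
      ... | c , c<m , at = trans (cong g (sym (last-at (<-trans i<r r<m) at))) (g-last c<m (lasts c c<m (ends at)))
        where
        ends : (q + i ≡ c ⊎ q + i ≡ c + m) → EndsRightForced c
        ends (inj₁ refl) = inj₁ (m≤m+n q i , +-monoʳ-< q i<r)
        ends (inj₂ q+i≡c+m) = inj₂ (subst (_< q + r) q+i≡c+m (+-monoʳ-< q i<r))
      n≤ : n ≤ suc (n' + i + r)
      n≤ = ≤-trans (+-monoʳ-≤ n' (s≤s (+-monoʳ-≤ r r≤i))) (≤-reflexive (regroup n' i r))
        where
        regroup : ∀ n' i r → n' + suc (r + i) ≡ suc (n' + i + r)
        regroup = solve-∀

-- The six cases of the theorem

module NoRemainderEven (r t : ℕ) (r≥1 : 1 ≤ r) where

  open ResidueClasses r (suc (2 * t)) 0 (s≤s z≤n)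

  r<r+r : r < r + r
  r<r+r = m<m+n r r≥1

  L≡ : ∀ c → L c ≡ suc (suc (2 * t))
  L≡ c = L-≥ {c} z≤n

  module _ (D : Subset n) (ic : IsIdCode r n D) where

    open LowerBound D ic

    -- The end vertices 0 and n - 1 force some chain to start and end in D.
    heavy-class : Σ ℕ λ c → c < m × suc (suc t) ≤ S c
    heavy-class with near-start
    ... | y , y≤r , dy with y <? r
    ...   | yes y<r = y , y<m , even-chain-ends t (L≡ y) dy (last-forced y (inj₁ (z≤n , y<r))) (class-bound y y<m)
      where
      y<m = ≤-<-trans y≤r r<m
    ...   | no y≮r with near-end
    ...     | i , r≤i , i<m , d[n'+i] =
      i , i<m , even-chain-ends t (L≡ i) di (subst (λ v → d v ≡ 1) (sym (last-at i<m (inj₁ refl))) d[n'+i])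
                                (class-bound i i<m)
      where
      di : d i ≡ 1
      di with r <? i
      ... | yes r<i = first-forced i r<i i<m
      ... | no r≮i = subst (λ v → d v ≡ 1) (trans (≤-antisym y≤r (≮⇒≥ y≮r)) (≤-antisym r≤i (≮⇒≥ r≮i))) dy

    lower : m * suc t + 1 ≤ ∣ D ∣
    lower with heavy-class
    ... | c , c<m , heavy = begin
      m * suc t + 1              ≡⟨ +-comm (m * suc t) 1 ⟩
      suc (m * suc t)            ≡⟨ cong suc (sym (∑-const (suc t) m)) ⟩
      suc (∑ (λ _ → suc t) m)    ≤⟨ ∑-mono-< m c (λ c c<m → even-chain t (L≡ c) (class-bound c c<m)) c<m heavy ⟩
      ∑ S m                      ≡⟨ sym ∣D∣≡∑S ⟩
      ∣ D ∣                      ∎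
      where open ≤-Reasoning

  T : ℕ → Pattern
  T c = ifBelow c r odds (ifBelow c (r + r) evens first+odds)

  T-low : ∀ {c} → c < r → T c ≡ odds
  T-low c<r = ifBelow-< c<r

  T-mid : ∀ {c} → r ≤ c → c < r + r → T c ≡ evens
  T-mid r≤c c<r+r = trans (ifBelow-≥ r≤c) (ifBelow-< c<r+r)

  T-high : ∀ {c} → r + r ≤ c → T c ≡ first+odds
  T-high r+r≤c = trans (ifBelow-≥ (≤-trans (m≤m+n r r) r+r≤c)) (ifBelow-≥ r+r≤c)

  open Design T

  γ : ℕ → ℕ
  γ c = suc t + between (r + r) m c

  γ-low : ∀ {c} → c < r + r → γ c ≡ suc t
  γ-low c<r+r = trans (cong (suc t +_) (between-< c<r+r (<⇒≤ r+r<m))) (+-identityʳ _)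

  γ-high : ∀ {c} → r + r ≤ c → c < m → γ c ≡ suc (suc t)
  γ-high r+r≤c c<m = trans (cong (suc t +_) (between-in r+r≤c c<m)) (+-comm (suc t) 1)

  ∑γ : ∑ γ m ≡ m * suc t + 1
  ∑γ = trans (∑-const+between (suc t) (r + r) m m (<⇒≤ r+r<m) ≤-refl) (cong (m * suc t +_) (m+n∸n≡m 1 (r + r)))

  size-T : ∀ c → c < m → size (T c) (L c) ≡ γ c
  size-T c c<m with r ≤? c | r + r ≤? c
  ... | _ | yes r+r≤c =
    trans (cong₂ size (T-high r+r≤c) (L≡ c)) (trans (size-first+odds-even t) (sym (γ-high r+r≤c c<m)))
  ... | yes r≤c | no r+r≰c =
    trans (cong₂ size (T-mid r≤c (≰⇒> r+r≰c)) (L≡ c)) (trans (size-evens-even t) (sym (γ-low (≰⇒> r+r≰c))))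
  ... | no r≰c | no r+r≰c =
    trans (cong₂ size (T-low (≰⇒> r≰c)) (L≡ c)) (trans (size-odds-even t) (sym (γ-low (≰⇒> r+r≰c))))

  firsts : ∀ c → suc r ≤ c → c < m → SelectsFirst (T c)
  firsts c r<c c<m with r + r ≤? c
  ... | yes r+r≤c = selectsFirst c (T-high r+r≤c) (λ _ → refl)
  ... | no r+r≰c = selectsFirst c (T-mid (<⇒≤ r<c) (≰⇒> r+r≰c)) (λ _ → refl)

  lasts : ∀ c → c < m → EndsRightForced c → SelectsLast c
  lasts c c<m (inj₁ (_ , c<r)) = selectsLast-even c t (L≡ c) (T-low c<r) odds-selectsOdds
  lasts c c<m (inj₂ c+m<r) = ⊥-elim (<⇒≱ c+m<r (≤-trans (<⇒≤ r<m) (m≤n+m m c)))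

  upper : Σ (Subset n) λ D → IsIdCode r n D × ∣ D ∣ ≡ m * suc t + 1
  upper =
    let D , ic , ∣D∣≡∑γ = design γ size-T firsts lasts
          (r , ≤-refl , selectsFirst r (T-mid ≤-refl r<r+r) (λ _ → refl))
          (r + r , r + r , r+r<m , m≤m+n r r , r+r<m , inj₁ refl ,
           selectsLast-even (r + r) t (L≡ (r + r)) (T-high ≤-refl) first+odds-selectsOdds)
          (0 , r , r + r , r≥1 , r<r+r , r+r<m ,
           inj₂ (subst SelectsOdds (sym (T-low r≥1)) odds-selectsOdds ,
                 subst SelectsEvens (sym (T-mid ≤-refl r<r+r)) evens-selectsEvens ,
                 subst SelectsOdds (sym (T-high ≤-refl)) first+odds-selectsOdds))
    in D , ic , trans ∣D∣≡∑γ ∑γ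

  minIdCodeSize : MinIdCodeSize r n (m * suc t + 1)
  minIdCodeSize = upper , lower

module NoRemainderOdd (r t : ℕ) (r≥1 : 1 ≤ r) where

  open ResidueClasses r (2 * t) 0 (s≤s z≤n)

  r<r+r : r < r + r
  r<r+r = m<m+n r r≥1

  L≡ : ∀ c → L c ≡ suc (2 * t)
  L≡ c = L-≥ {c} z≤n

  β : ℕ → ℕ
  β c = t + (between 0 r c + between (suc r) m c)

  β-low : ∀ {c} → c < r → β c ≡ suc t
  β-low c<r = trans (cong₂ (λ a b → t + (a + b)) (between-in z≤n c<r) (between-< (m<n⇒m<1+n c<r) r<m)) (+-comm t 1)

  β-mid : ∀ {c} → r ≤ c → c < suc r → β c ≡ t
  β-mid r≤c c<1+r = trans (cong₂ (λ a b → t + (a + b)) (between-≥ 0 r≤c) (between-< c<1+r r<m)) (+-identityʳ t)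

  β-high : ∀ {c} → suc r ≤ c → c < m → β c ≡ suc t
  β-high r<c c<m = trans (cong₂ (λ a b → t + (a + b)) (between-≥ 0 (<⇒≤ r<c)) (between-in r<c c<m)) (+-comm t 1)

  ∑β : ∑ β m ≡ m * t + (r + r)
  ∑β = trans (∑-const+between₂ t 0 r (suc r) m m z≤n (<⇒≤ r<m) r<m ≤-refl) (cong (λ k → m * t + (r + k)) (m+n∸m≡n r r))

  lower : ∀ D → IsIdCode r n D → m * t + (r + r) ≤ ∣ D ∣
  lower D ic = subst (_≤ ∣ D ∣) ∑β (∑≤∣D∣ β β≤S)
    where
    open LowerBound D ic
    β≤S : ∀ c → c < m → β c ≤ S c
    β≤S c c<m with r ≤? c | suc r ≤? c
    ... | _ | yes r<c = subst (_≤ S c) (sym (β-high r<c c<m))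
                          (odd-chain-end t (L≡ c) (inj₁ (first-forced c r<c c<m)) (class-bound c c<m))
    ... | yes r≤c | no r≮c = subst (_≤ S c) (sym (β-mid r≤c (≰⇒> r≮c))) (odd-chain t (L≡ c) (class-bound c c<m))
    ... | no r≰c | no _ = subst (_≤ S c) (sym (β-low (≰⇒> r≰c)))
                          (odd-chain-end t (L≡ c) (inj₂ (last-forced c (inj₁ (z≤n , ≰⇒> r≰c)))) (class-bound c c<m))

  T : ℕ → Pattern
  T c = ifBelow c r evens (ifBelow c (suc r) odds evens)

  T-low : ∀ {c} → c < r → T c ≡ evens
  T-low c<r = ifBelow-< c<r

  T-mid : ∀ {c} → r ≤ c → c < suc r → T c ≡ odds
  T-mid r≤c c<1+r = trans (ifBelow-≥ r≤c) (ifBelow-< c<1+r)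

  T-high : ∀ {c} → suc r ≤ c → T c ≡ evens
  T-high r<c = trans (ifBelow-≥ (<⇒≤ r<c)) (ifBelow-≥ r<c)

  open Design T

  size-T : ∀ c → c < m → size (T c) (L c) ≡ β c
  size-T c c<m with r ≤? c | suc r ≤? c
  ... | _ | yes r<c = trans (cong₂ size (T-high r<c) (L≡ c)) (trans (size-evens-odd t) (sym (β-high r<c c<m)))
  ... | yes r≤c | no r≮c =
    trans (cong₂ size (T-mid r≤c (≰⇒> r≮c)) (L≡ c)) (trans (size-odds-odd t) (sym (β-mid r≤c (≰⇒> r≮c))))
  ... | no r≰c | no _ =
    trans (cong₂ size (T-low (≰⇒> r≰c)) (L≡ c)) (trans (size-evens-odd t) (sym (β-low (≰⇒> r≰c))))

  firsts : ∀ c → suc r ≤ c → c < m → SelectsFirst (T c)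
  firsts c r<c c<m = selectsFirst c (T-high r<c) (λ _ → refl)

  lasts : ∀ c → c < m → EndsRightForced c → SelectsLast c
  lasts c c<m (inj₁ (_ , c<r)) = selectsLast-odd c t (L≡ c) (T-low c<r) evens-selectsEvens
  lasts c c<m (inj₂ c+m<r) = ⊥-elim (<⇒≱ c+m<r (≤-trans (<⇒≤ r<m) (m≤n+m m c)))

  upper : Σ (Subset n) λ D → IsIdCode r n D × ∣ D ∣ ≡ m * t + (r + r)
  upper =
    let D , ic , ∣D∣≡∑β = design β size-T firsts lasts
          (0 , z≤n , selectsFirst 0 (T-low r≥1) (λ _ → refl))
          (r + r , r + r , r+r<m , m≤m+n r r , r+r<m , inj₁ refl ,
           selectsLast-odd (r + r) t (L≡ (r + r)) (T-high r<r+r) evens-selectsEvens)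
          (0 , r , r + r , r≥1 , r<r+r , r+r<m ,
           inj₁ (subst SelectsEvens (sym (T-low r≥1)) evens-selectsEvens ,
                 subst SelectsOdds (sym (T-mid ≤-refl ≤-refl)) odds-selectsOdds ,
                 subst SelectsEvens (sym (T-high r<r+r)) evens-selectsEvens))
    in D , ic , trans ∣D∣≡∑β ∑β

  minIdCodeSize : MinIdCodeSize r n (m * t + (r + r))
  minIdCodeSize = upper , lower

module SmallRemainderEven (r t q' : ℕ) (r≥1 : 1 ≤ r) (q'≤r : q' ≤ r) where

  private
    q = suc q'
    r<r+r = m<m+n r r≥1

  open ResidueClasses r (suc (2 * t)) q (s≤s (≤-<-trans q'≤r r<r+r))

  q≤1+r : q ≤ suc r
  q≤1+r = s≤s q'≤r

  1+r≤q+r : suc r ≤ q + r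
  1+r≤q+r = s≤s (m≤n+m r q')

  q+r≤m : q + r ≤ m
  q+r≤m = s≤s (+-monoˡ-≤ r q'≤r)

  L-short : ∀ {c} → c < q → L c ≡ suc (2 * suc t)
  L-short c<q = trans (L-< c<q) (cong suc (sym (2*-suc t)))

  L-long : ∀ {c} → q ≤ c → L c ≡ suc (suc (2 * t))
  L-long = L-≥

  β : ℕ → ℕ
  β c = suc t + between (suc r) (q + r) c

  β-outside : ∀ {c} → c < suc r ⊎ q + r ≤ c → β c ≡ suc t
  β-outside (inj₁ c<1+r) = trans (cong (suc t +_) (between-< c<1+r 1+r≤q+r)) (+-identityʳ _)
  β-outside (inj₂ q+r≤c) = trans (cong (suc t +_) (between-≥ (suc r) q+r≤c)) (+-identityʳ _)

  β-inside : ∀ {c} → suc r ≤ c → c < q + r → β c ≡ suc (suc t)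
  β-inside r<c c<q+r = trans (cong (suc t +_) (between-in r<c c<q+r)) (+-comm (suc t) 1)

  ∑β : ∑ β m ≡ m * suc t + q'
  ∑β = trans (∑-const+between (suc t) (suc r) (q + r) m 1+r≤q+r q+r≤m) (cong (m * suc t +_) (m+n∸n≡m q' r))

  lower : ∀ D → IsIdCode r n D → m * suc t + q ≤ ∣ D ∣
  lower D ic with near-start
    where open LowerBound D ic
  ... | y , y≤r , dy = begin
    m * suc t + q           ≡⟨ +-suc (m * suc t) q' ⟩
    suc (m * suc t + q')    ≡⟨ cong suc (sym ∑β) ⟩
    suc (∑ β m)             ≤⟨ ∑-mono-< m y β≤S (≤-<-trans y≤r r<m) heavy ⟩
    ∑ S m                   ≡⟨ sym ∣D∣≡∑S ⟩
    ∣ D ∣                   ∎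
    where
    open LowerBound D ic
    open ≤-Reasoning
    β≤S : ∀ c → c < m → β c ≤ S c
    β≤S c c<m with q ≤? c
    ... | no q≰c = subst (_≤ S c) (sym (β-outside (inj₁ (<-≤-trans (≰⇒> q≰c) q≤1+r))))
                         (odd-chain (suc t) (L-short (≰⇒> q≰c)) (class-bound c c<m))
    ... | yes q≤c with suc r ≤? c | q + r ≤? c
    ...   | no r≮c | _ =
      subst (_≤ S c) (sym (β-outside (inj₁ (≰⇒> r≮c)))) (even-chain t (L-long q≤c) (class-bound c c<m))
    ...   | yes _ | yes q+r≤c =
      subst (_≤ S c) (sym (β-outside (inj₂ q+r≤c))) (even-chain t (L-long q≤c) (class-bound c c<m))
    ...   | yes r<c | no q+r≰c = subst (_≤ S c) (sym (β-inside r<c (≰⇒> q+r≰c)))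
              (even-chain-ends t (L-long q≤c) (first-forced c r<c c<m) (last-forced c (inj₁ (q≤c , ≰⇒> q+r≰c)))
                               (class-bound c c<m))
    -- The vertex of D dominating 0 starts its chain, which then has one code vertex more than β counts.
    heavy : β y < S y
    heavy with q ≤? y
    ... | no q≰y = subst (_< S y) (sym (β-outside (inj₁ (s≤s y≤r))))
                         (odd-chain-end (suc t) (L-short (≰⇒> q≰y)) (inj₁ dy) (class-bound y (≤-<-trans y≤r r<m)))
    ... | yes q≤y = subst (_< S y) (sym (β-outside (inj₁ (s≤s y≤r))))
                          (even-chain-ends t (L-long q≤y) dy (last-forced y (inj₁ (q≤y , <-≤-trans (s≤s y≤r) 1+r≤q+r)))
                                           (class-bound y (≤-<-trans y≤r r<m)))

  T : ℕ → Pattern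
  T c = ifBelow c 1 evens (ifBelow c (suc r) odds (ifBelow c (q + r) evens+last evens))

  T-zero : ∀ {c} → c < 1 → T c ≡ evens
  T-zero = ifBelow-<

  T-low : ∀ {c} → 1 ≤ c → c < suc r → T c ≡ odds
  T-low 1≤c c<1+r = trans (ifBelow-≥ 1≤c) (ifBelow-< c<1+r)

  T-mid : ∀ {c} → suc r ≤ c → c < q + r → T c ≡ evens+last
  T-mid r<c c<q+r = trans (ifBelow-≥ (≤-trans (s≤s z≤n) r<c)) (trans (ifBelow-≥ r<c) (ifBelow-< c<q+r))

  T-high : ∀ {c} → q + r ≤ c → T c ≡ evens
  T-high q+r≤c = trans (ifBelow-≥ (≤-trans (s≤s z≤n) r<c)) (trans (ifBelow-≥ r<c) (ifBelow-≥ q+r≤c))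
    where
    r<c = ≤-trans 1+r≤q+r q+r≤c

  open Design T

  γ : ℕ → ℕ
  γ c = suc t + (between (suc r) (q + r) c + between 0 1 c)

  ∑γ : ∑ γ m ≡ m * suc t + q
  ∑γ = trans (∑-const+between₂ (suc t) (suc r) (q + r) 0 1 m 1+r≤q+r q+r≤m z≤n (s≤s z≤n))
             (cong (m * suc t +_) (trans (cong (_+ 1) (m+n∸n≡m q' r)) (+-comm q' 1)))

  γ-zero : ∀ {c} → c < 1 → γ c ≡ suc (suc t)
  γ-zero c<1 = trans (cong₂ (λ a b → suc t + (a + b)) (between-< (<-≤-trans c<1 (s≤s z≤n)) 1+r≤q+r) (between-in z≤n c<1))
                     (+-comm (suc t) 1)

  γ-between : ∀ {c} → 1 ≤ c → β c ≡ γ c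
  γ-between {c} 1≤c = cong (suc t +_) (sym (trans (cong (between (suc r) (q + r) c +_) (between-≥ 0 1≤c)) (+-identityʳ _)))

  size-T : ∀ c → c < m → size (T c) (L c) ≡ γ c
  size-T c c<m with 1 ≤? c
  ... | no 1≰c = trans (cong₂ size (T-zero (≰⇒> 1≰c)) (L-short (<-≤-trans (≰⇒> 1≰c) (s≤s z≤n))))
                       (trans (size-evens-odd (suc t)) (sym (γ-zero (≰⇒> 1≰c))))
  ... | yes 1≤c = trans by-region (γ-between 1≤c)
    where
    odds-size : size odds (L c) ≡ suc t
    odds-size with q ≤? c
    ... | yes q≤c = trans (cong (size odds) (L-long q≤c)) (size-odds-even t)
    ... | no q≰c = trans (cong (size odds) (L-short (≰⇒> q≰c))) (size-odds-odd (suc t))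
    by-region : size (T c) (L c) ≡ β c
    by-region with suc r ≤? c | q + r ≤? c
    ... | no r≮c | _ =
      trans (cong (λ π → size π (L c)) (T-low 1≤c (≰⇒> r≮c))) (trans odds-size (sym (β-outside (inj₁ (≰⇒> r≮c)))))
    ... | yes r<c | no q+r≰c = trans (cong₂ size (T-mid r<c (≰⇒> q+r≰c)) (L-long (≤-trans q≤1+r r<c)))
                                     (trans (size-evens+last-even t) (sym (β-inside r<c (≰⇒> q+r≰c))))
    ... | yes r<c | yes q+r≤c = trans (cong₂ size (T-high q+r≤c) (L-long (≤-trans q≤1+r r<c)))
                                      (trans (size-evens-even t) (sym (β-outside (inj₂ q+r≤c))))

  firsts : ∀ c → suc r ≤ c → c < m → SelectsFirst (T c)
  firsts c r<c c<m with q + r ≤? c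
  ... | yes q+r≤c = selectsFirst c (T-high q+r≤c) (λ _ → refl)
  ... | no q+r≰c = selectsFirst c (T-mid r<c (≰⇒> q+r≰c)) (λ _ → refl)

  lasts : ∀ c → c < m → EndsRightForced c → SelectsLast c
  lasts c c<m (inj₁ (q≤c , c<q+r)) with suc r ≤? c
  ... | yes r<c = selectsLast-evens+last c (T-mid r<c c<q+r)
  ... | no r≮c = selectsLast-even c t (L-long q≤c) (T-low (≤-trans (s≤s z≤n) q≤c) (≰⇒> r≮c)) odds-selectsOdds
  lasts c c<m (inj₂ c+m<q+r) = ⊥-elim (<⇒≱ c+m<q+r (≤-trans q+r≤m (m≤n+m m c)))

  upper : Σ (Subset n) λ D → IsIdCode r n D × ∣ D ∣ ≡ m * suc t + q
  upper =
    let D , ic , ∣D∣≡∑γ = design γ size-T firsts lasts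
          (0 , z≤n , selectsFirst 0 (T-zero (s≤s z≤n)) (λ _ → refl))
          (0 , r + r ∸ q' , s≤s z≤n , r≤i , s≤s (m∸n≤m (r + r) q') , inj₂ (cong suc (m+[n∸m]≡n q'≤r+r)) ,
           selectsLast-odd 0 (suc t) (L-short (s≤s z≤n)) (T-zero (s≤s z≤n)) evens-selectsEvens)
          (0 , 1 , r + r , s≤s z≤n , ≤-<-trans r≥1 r<r+r , r+r<m ,
           inj₁ (subst SelectsEvens (sym (T-zero (s≤s z≤n))) evens-selectsEvens ,
                 subst SelectsOdds (sym (T-low ≤-refl (s≤s r≥1))) odds-selectsOdds ,
                 evens-at-r+r))
    in D , ic , trans ∣D∣≡∑γ ∑γ
    where
    q'≤r+r = ≤-trans q'≤r (m≤m+n r r)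
    r≤i : r ≤ r + r ∸ q'
    r≤i = +-cancelˡ-≤ q' _ _ (≤-trans (+-monoˡ-≤ r q'≤r) (≤-reflexive (sym (m+[n∸m]≡n q'≤r+r))))
    evens-at-r+r : SelectsEvens (T (r + r))
    evens-at-r+r with q + r ≤? r + r
    ... | yes q+r≤r+r = subst SelectsEvens (sym (T-high q+r≤r+r)) evens-selectsEvens
    ... | no q+r≰r+r = subst SelectsEvens (sym (T-mid r<r+r (≰⇒> q+r≰r+r))) evens+last-selectsEvens

  minIdCodeSize : MinIdCodeSize r n (m * suc t + q)
  minIdCodeSize = upper , lower

module SmallRemainderOdd (r t q' : ℕ) (r≥1 : 1 ≤ r) (q'≤r : q' ≤ r) where

  private
    q = suc q'
    r<r+r = m<m+n r r≥1

  open ResidueClasses r (2 * t) q (s≤s (≤-<-trans q'≤r r<r+r))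

  q≤1+r : q ≤ suc r
  q≤1+r = s≤s q'≤r

  q+r≤m : q + r ≤ m
  q+r≤m = s≤s (+-monoˡ-≤ r q'≤r)

  L-short : ∀ {c} → q ≤ c → L c ≡ suc (2 * t)
  L-short = L-≥

  L-long : ∀ {c} → c < q → L c ≡ suc (suc (2 * t))
  L-long = L-<

  q+r+r≡q'+m : q + (r + r) ≡ q' + m
  q+r+r≡q'+m = sym (+-suc q' (r + r))

  lower : ∀ D → IsIdCode r n D → m * suc t ≤ ∣ D ∣
  lower D ic = subst (_≤ ∣ D ∣) (∑-const (suc t) m) (∑≤∣D∣ (λ _ → suc t) 1+t≤S)
    where
    open LowerBound D ic
    1+t≤S : ∀ c → c < m → suc t ≤ S c
    1+t≤S c c<m with q ≤? c | suc r ≤? c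
    ... | no q≰c | _ = even-chain t (L-long (≰⇒> q≰c)) (class-bound c c<m)
    ... | yes q≤c | yes r<c = odd-chain-end t (L-short q≤c) (inj₁ (first-forced c r<c c<m)) (class-bound c c<m)
    ... | yes q≤c | no r≮c = odd-chain-end t (L-short q≤c)
                               (inj₂ (last-forced c (inj₁ (q≤c , <-≤-trans (≰⇒> r≮c) (s≤s (m≤n+m r q'))))))
                               (class-bound c c<m)

  module UpperBelow (q≤r : q ≤ r) where

    T : ℕ → Pattern
    T c = ifBelow c q odds (ifBelow c (r + r) evens first+odds)

    T-low : ∀ {c} → c < q → T c ≡ odds
    T-low = ifBelow-<

    T-mid : ∀ {c} → q ≤ c → c < r + r → T c ≡ evens
    T-mid q≤c c<r+r = trans (ifBelow-≥ q≤c) (ifBelow-< c<r+r)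

    T-high : ∀ {c} → r + r ≤ c → T c ≡ first+odds
    T-high r+r≤c = trans (ifBelow-≥ (≤-trans q≤r (≤-trans (m≤m+n r r) r+r≤c))) (ifBelow-≥ r+r≤c)

    open Design T

    size-T : ∀ c → c < m → size (T c) (L c) ≡ suc t
    size-T c c<m with q ≤? c | r + r ≤? c
    ... | no q≰c | _ = trans (cong₂ size (T-low (≰⇒> q≰c)) (L-long (≰⇒> q≰c))) (size-odds-even t)
    ... | yes q≤c | no r+r≰c = trans (cong₂ size (T-mid q≤c (≰⇒> r+r≰c)) (L-short q≤c)) (size-evens-odd t)
    ... | yes q≤c | yes r+r≤c = trans (cong₂ size (T-high r+r≤c) (L-short q≤c)) (size-first+odds-odd t)

    firsts : ∀ c → suc r ≤ c → c < m → SelectsFirst (T c)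
    firsts c r<c c<m with r + r ≤? c
    ... | yes r+r≤c = selectsFirst c (T-high r+r≤c) (λ _ → refl)
    ... | no r+r≰c = selectsFirst c (T-mid (≤-trans q≤r (<⇒≤ r<c)) (≰⇒> r+r≰c)) (λ _ → refl)

    lasts : ∀ c → c < m → EndsRightForced c → SelectsLast c
    lasts c c<m (inj₁ (q≤c , c<q+r)) =
      selectsLast-odd c t (L-short q≤c) (T-mid q≤c (<-≤-trans c<q+r (+-monoˡ-≤ r q≤r))) evens-selectsEvens
    lasts c c<m (inj₂ c+m<q+r) = ⊥-elim (<⇒≱ c+m<q+r (≤-trans q+r≤m (m≤n+m m c)))

    upper : Σ (Subset n) λ D → IsIdCode r n D × ∣ D ∣ ≡ m * suc t
    upper =
      let D , ic , ∣D∣≡∑ = design (λ _ → suc t) size-T firsts lasts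
            (r , ≤-refl , selectsFirst r (T-mid q≤r r<r+r) (λ _ → refl))
            (q' , r + r , <-trans (n<1+n q') (s≤s (≤-<-trans q'≤r r<r+r)) , m≤m+n r r , r+r<m , inj₂ q+r+r≡q'+m ,
             selectsLast-even q' t (L-long (n<1+n q')) (T-low (n<1+n q')) odds-selectsOdds)
            (0 , r , r + r , r≥1 , r<r+r , r+r<m ,
             inj₂ (subst SelectsOdds (sym (T-low (s≤s z≤n))) odds-selectsOdds ,
                   subst SelectsEvens (sym (T-mid q≤r r<r+r)) evens-selectsEvens ,
                   subst SelectsOdds (sym (T-high ≤-refl)) first+odds-selectsOdds))
      in D , ic , trans ∣D∣≡∑ (∑-const (suc t) m)

  module UpperAt (q≡1+r : q ≡ suc r) where

    T : ℕ → Pattern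
    T c = ifBelow c 1 evens (ifBelow c (suc r) odds evens)

    T-zero : ∀ {c} → c < 1 → T c ≡ evens
    T-zero = ifBelow-<

    T-low : ∀ {c} → 1 ≤ c → c < suc r → T c ≡ odds
    T-low 1≤c c<1+r = trans (ifBelow-≥ 1≤c) (ifBelow-< c<1+r)

    T-high : ∀ {c} → suc r ≤ c → T c ≡ evens
    T-high r<c = trans (ifBelow-≥ (≤-trans (s≤s z≤n) r<c)) (ifBelow-≥ r<c)

    open Design T

    L-short′ : ∀ {c} → suc r ≤ c → L c ≡ suc (2 * t)
    L-short′ {c} r<c = L-short (subst (_≤ c) (sym q≡1+r) r<c)

    L-long′ : ∀ {c} → c < suc r → L c ≡ suc (suc (2 * t))
    L-long′ {c} c<1+r = L-long (subst (c <_) (sym q≡1+r) c<1+r)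

    size-T : ∀ c → c < m → size (T c) (L c) ≡ suc t
    size-T c c<m with 1 ≤? c | suc r ≤? c
    ... | no 1≰c | _ = trans (cong₂ size (T-zero (≰⇒> 1≰c)) (L-long′ (<-≤-trans (≰⇒> 1≰c) (s≤s z≤n)))) (size-evens-even t)
    ... | yes 1≤c | no r≮c = trans (cong₂ size (T-low 1≤c (≰⇒> r≮c)) (L-long′ (≰⇒> r≮c))) (size-odds-even t)
    ... | yes _ | yes r<c = trans (cong₂ size (T-high r<c) (L-short′ r<c)) (size-evens-odd t)

    firsts : ∀ c → suc r ≤ c → c < m → SelectsFirst (T c)
    firsts c r<c c<m = selectsFirst c (T-high r<c) (λ _ → refl)

    lasts : ∀ c → c < m → EndsRightForced c → SelectsLast c
    lasts c c<m (inj₁ (q≤c , _)) = selectsLast-odd c t (L-short q≤c) (T-high r<c) evens-selectsEvens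
      where
      r<c = subst (_≤ c) q≡1+r q≤c
    lasts c c<m (inj₂ c+m<q+r) = ⊥-elim (<⇒≱ c+m<q+r (≤-trans q+r≤m (m≤n+m m c)))

    upper : Σ (Subset n) λ D → IsIdCode r n D × ∣ D ∣ ≡ m * suc t
    upper =
      let D , ic , ∣D∣≡∑ = design (λ _ → suc t) size-T firsts lasts
            (0 , z≤n , selectsFirst 0 (T-zero (s≤s z≤n)) (λ _ → refl))
            (q' , r + r , <-trans (n<1+n q') (s≤s (≤-<-trans q'≤r r<r+r)) , m≤m+n r r , r+r<m , inj₂ q+r+r≡q'+m ,
             selectsLast-even q' t (L-long (n<1+n q')) (T-low 1≤q' q'<1+r) odds-selectsOdds)
            (0 , 1 , r + r , s≤s z≤n , ≤-<-trans r≥1 r<r+r , r+r<m ,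
             inj₁ (subst SelectsEvens (sym (T-zero (s≤s z≤n))) evens-selectsEvens ,
                   subst SelectsOdds (sym (T-low ≤-refl (s≤s r≥1))) odds-selectsOdds ,
                   subst SelectsEvens (sym (T-high r<r+r)) evens-selectsEvens))
      in D , ic , trans ∣D∣≡∑ (∑-const (suc t) m)
      where
      q'≡r = suc-injective q≡1+r
      1≤q' = subst (1 ≤_) (sym q'≡r) r≥1
      q'<1+r = subst (_< suc r) (sym q'≡r) (n<1+n r)

  minIdCodeSize : MinIdCodeSize r n (m * suc t)
  minIdCodeSize with q ≤? r
  ... | yes q≤r = UpperBelow.upper q≤r , lower
  ... | no q≰r = UpperAt.upper (≤-antisym q≤1+r (≰⇒> q≰r)) , lower

module LargeRemainderEven (r t e : ℕ) (e≥1 : 1 ≤ e) (q≤r+r : suc r + e ≤ r + r) where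

  private
    q = suc r + e

  open ResidueClasses r (suc (2 * t)) q (s≤s q≤r+r)

  e<r : e < r
  e<r = +-cancelˡ-< r e r q≤r+r

  r≥1 : 1 ≤ r
  r≥1 = ≤-trans e≥1 (<⇒≤ e<r)

  r<r+r : r < r + r
  r<r+r = m<m+n r r≥1

  1+r≤q : suc r ≤ q
  1+r≤q = m≤m+n (suc r) e

  q+r≡e+m : q + r ≡ e + m
  q+r≡e+m = regroup r e
    where
    regroup : ∀ r e → suc r + e + r ≡ e + suc (r + r)
    regroup = solve-∀

  L-long : ∀ {c} → c < q → L c ≡ suc (2 * suc t)
  L-long c<q = trans (L-< c<q) (cong suc (sym (2*-suc t)))

  L-short : ∀ {c} → q ≤ c → L c ≡ suc (suc (2 * t))
  L-short = L-≥

  β : ℕ → ℕ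
  β c = suc t + (between 0 e c + between (suc r) m c)

  β-low : ∀ {c} → c < e → β c ≡ suc (suc t)
  β-low c<e = trans (cong₂ (λ a b → suc t + (a + b)) (between-in z≤n c<e) (between-< (<-trans c<e (m<n⇒m<1+n e<r)) r<m))
                    (+-comm (suc t) 1)

  β-mid : ∀ {c} → e ≤ c → c < suc r → β c ≡ suc t
  β-mid e≤c c<1+r = trans (cong₂ (λ a b → suc t + (a + b)) (between-≥ 0 e≤c) (between-< c<1+r r<m)) (+-identityʳ _)

  β-high : ∀ {c} → suc r ≤ c → c < m → β c ≡ suc (suc t)
  β-high r<c c<m = trans (cong₂ (λ a b → suc t + (a + b)) (between-≥ 0 (≤-trans (<⇒≤ e<r) (<⇒≤ r<c))) (between-in r<c c<m))
                         (+-comm (suc t) 1)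

  ∑β : ∑ β m ≡ m * suc t + (e + r)
  ∑β = trans (∑-const+between₂ (suc t) 0 e (suc r) m m z≤n (≤-trans (<⇒≤ e<r) (<⇒≤ r<m)) r<m ≤-refl)
             (cong (λ k → m * suc t + (e + k)) (m+n∸m≡n r r))

  lower : ∀ D → IsIdCode r n D → m * suc t + (e + r) ≤ ∣ D ∣
  lower D ic = subst (_≤ ∣ D ∣) ∑β (∑≤∣D∣ β β≤S)
    where
    open LowerBound D ic
    β≤S : ∀ c → c < m → β c ≤ S c
    β≤S c c<m with e ≤? c | suc r ≤? c
    ... | no e≰c | _ = subst (_≤ S c) (sym (β-low (≰⇒> e≰c)))
        (odd-chain-end (suc t) (L-long (<-trans (≰⇒> e≰c) (<-≤-trans (m<n⇒m<1+n e<r) 1+r≤q)))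
          (inj₂ (last-forced c (inj₂ (subst (c + m <_) (sym q+r≡e+m) (+-monoˡ-< m (≰⇒> e≰c)))))) (class-bound c c<m))
    ... | yes e≤c | no r≮c = subst (_≤ S c) (sym (β-mid e≤c (≰⇒> r≮c)))
        (odd-chain (suc t) (L-long (<-≤-trans (≰⇒> r≮c) 1+r≤q)) (class-bound c c<m))
    ... | yes _ | yes r<c with q ≤? c
    ...   | no q≰c = subst (_≤ S c) (sym (β-high r<c c<m))
        (odd-chain-end (suc t) (L-long (≰⇒> q≰c)) (inj₁ (first-forced c r<c c<m)) (class-bound c c<m))
    ...   | yes q≤c = subst (_≤ S c) (sym (β-high r<c c<m))
        (even-chain-ends t (L-short q≤c) (first-forced c r<c c<m)
          (last-forced c (inj₁ (q≤c , <-≤-trans c<m (≤-trans (m≤n+m m e) (≤-reflexive (sym q+r≡e+m))))))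
          (class-bound c c<m))

  T : ℕ → Pattern
  T c = ifBelow c e evens (ifBelow c (suc r) odds (ifBelow c q evens evens+last))

  T-low : ∀ {c} → c < e → T c ≡ evens
  T-low = ifBelow-<

  T-mid : ∀ {c} → e ≤ c → c < suc r → T c ≡ odds
  T-mid e≤c c<1+r = trans (ifBelow-≥ e≤c) (ifBelow-< c<1+r)

  T-high : ∀ {c} → suc r ≤ c → c < q → T c ≡ evens
  T-high r<c c<q = trans (ifBelow-≥ (≤-trans (<⇒≤ e<r) (<⇒≤ r<c))) (trans (ifBelow-≥ r<c) (ifBelow-< c<q))

  T-top : ∀ {c} → q ≤ c → T c ≡ evens+last
  T-top q≤c = trans (ifBelow-≥ (≤-trans (<⇒≤ e<r) (<⇒≤ r<c))) (trans (ifBelow-≥ r<c) (ifBelow-≥ q≤c))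
    where
    r<c = ≤-trans 1+r≤q q≤c

  open Design T

  size-T : ∀ c → c < m → size (T c) (L c) ≡ β c
  size-T c c<m with e ≤? c | suc r ≤? c
  ... | no e≰c | _ = trans (cong₂ size (T-low (≰⇒> e≰c)) (L-long (<-trans (≰⇒> e≰c) (<-≤-trans (m<n⇒m<1+n e<r) 1+r≤q))))
                           (trans (size-evens-odd (suc t)) (sym (β-low (≰⇒> e≰c))))
  ... | yes e≤c | no r≮c = trans (cong₂ size (T-mid e≤c (≰⇒> r≮c)) (L-long (<-≤-trans (≰⇒> r≮c) 1+r≤q)))
                                 (trans (size-odds-odd (suc t)) (sym (β-mid e≤c (≰⇒> r≮c))))
  ... | yes _ | yes r<c with q ≤? c
  ...   | no q≰c = trans (cong₂ size (T-high r<c (≰⇒> q≰c)) (L-long (≰⇒> q≰c)))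
                         (trans (size-evens-odd (suc t)) (sym (β-high r<c c<m)))
  ...   | yes q≤c = trans (cong₂ size (T-top q≤c) (L-short q≤c))
                          (trans (size-evens+last-even t) (sym (β-high r<c c<m)))

  firsts : ∀ c → suc r ≤ c → c < m → SelectsFirst (T c)
  firsts c r<c c<m with q ≤? c
  ... | yes q≤c = selectsFirst c (T-top q≤c) (λ _ → refl)
  ... | no q≰c = selectsFirst c (T-high r<c (≰⇒> q≰c)) (λ _ → refl)

  lasts : ∀ c → c < m → EndsRightForced c → SelectsLast c
  lasts c c<m (inj₁ (q≤c , _)) = selectsLast-evens+last c (T-top q≤c)
  lasts c c<m (inj₂ c+m<q+r) =
    selectsLast-odd c (suc t) (L-long (<-trans c<e (<-≤-trans (m<n⇒m<1+n e<r) 1+r≤q))) (T-low c<e) evens-selectsEvens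
    where
    c<e = +-cancelʳ-< m c e (subst (c + m <_) q+r≡e+m c+m<q+r)

  upper : Σ (Subset n) λ D → IsIdCode r n D × ∣ D ∣ ≡ m * suc t + (e + r)
  upper =
    let D , ic , ∣D∣≡∑β = design β size-T firsts lasts
          (0 , z≤n , selectsFirst 0 (T-low e≥1) (λ _ → refl))
          (r + e , r + r , <-trans r+e<q (s≤s q≤r+r) , m≤m+n r r , r+r<m , inj₂ q+r+r≡r+e+m ,
           selectsLast-odd (r + e) (suc t) (L-long r+e<q) (T-high r<r+e r+e<q) evens-selectsEvens)
          (0 , r , r + r , r≥1 , r<r+r , r+r<m ,
           inj₁ (subst SelectsEvens (sym (T-low e≥1)) evens-selectsEvens ,
                 subst SelectsOdds (sym (T-mid (<⇒≤ e<r) (n<1+n r))) odds-selectsOdds ,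
                 subst SelectsEvens (sym (T-top q≤r+r)) evens+last-selectsEvens))
    in D , ic , trans ∣D∣≡∑β ∑β
    where
    r+e<q : r + e < q
    r+e<q = n<1+n (r + e)
    r<r+e : suc r ≤ r + e
    r<r+e = ≤-trans (≤-reflexive (+-comm 1 r)) (+-monoʳ-≤ r e≥1)
    q+r+r≡r+e+m : q + (r + r) ≡ r + e + m
    q+r+r≡r+e+m = regroup r e
      where
      regroup : ∀ r e → suc r + e + (r + r) ≡ r + e + suc (r + r)
      regroup = solve-∀

  minIdCodeSize : MinIdCodeSize r n (m * suc t + (e + r))
  minIdCodeSize = upper , lower

module LargeRemainderOdd (r t e : ℕ) (e≥1 : 1 ≤ e) (q≤r+r : suc r + e ≤ r + r) where

  private
    q = suc r + e

  open ResidueClasses r (2 * t) q (s≤s q≤r+r)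

  e<r : e < r
  e<r = +-cancelˡ-< r e r q≤r+r

  r≥1 : 1 ≤ r
  r≥1 = ≤-trans e≥1 (<⇒≤ e<r)

  1+r≤q : suc r ≤ q
  1+r≤q = m≤m+n (suc r) e

  1+e<q : suc e < q
  1+e<q = s≤s (+-monoˡ-≤ e r≥1)

  q+r≡e+m : q + r ≡ e + m
  q+r≡e+m = regroup r e
    where
    regroup : ∀ r e → suc r + e + r ≡ e + suc (r + r)
    regroup = solve-∀

  L-long : ∀ {c} → c < q → L c ≡ suc (suc (2 * t))
  L-long = L-<

  L-short : ∀ {c} → q ≤ c → L c ≡ suc (2 * t)
  L-short = L-≥

  lower : ∀ D → IsIdCode r n D → m * suc t ≤ ∣ D ∣
  lower D ic = subst (_≤ ∣ D ∣) (∑-const (suc t) m) (∑≤∣D∣ (λ _ → suc t) 1+t≤S)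
    where
    open LowerBound D ic
    1+t≤S : ∀ c → c < m → suc t ≤ S c
    1+t≤S c c<m with q ≤? c
    ... | no q≰c = even-chain t (L-long (≰⇒> q≰c)) (class-bound c c<m)
    ... | yes q≤c = odd-chain-end t (L-short q≤c) (inj₁ (first-forced c (≤-trans 1+r≤q q≤c) c<m)) (class-bound c c<m)

  T : ℕ → Pattern
  T c = ifBelow c e odds (ifBelow c (suc e) evens (ifBelow c (suc r) odds evens))

  T-low : ∀ {c} → c < e → T c ≡ odds
  T-low = ifBelow-<

  T-at-e : T e ≡ evens
  T-at-e = trans (ifBelow-≥ {c = e} ≤-refl) (ifBelow-< (n<1+n e))

  T-mid : ∀ {c} → suc e ≤ c → c < suc r → T c ≡ odds
  T-mid e<c c<1+r = trans (ifBelow-≥ (<⇒≤ e<c)) (trans (ifBelow-≥ e<c) (ifBelow-< c<1+r))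

  T-high : ∀ {c} → suc r ≤ c → T c ≡ evens
  T-high r<c = trans (ifBelow-≥ (<⇒≤ e<c)) (trans (ifBelow-≥ e<c) (ifBelow-≥ r<c))
    where
    e<c = <-≤-trans (m<n⇒m<1+n e<r) r<c

  open Design T

  size-T : ∀ c → c < m → size (T c) (L c) ≡ suc t
  size-T c c<m with e ≤? c | suc e ≤? c | suc r ≤? c
  ... | no e≰c | _ | _ =
    trans (cong₂ size (T-low (≰⇒> e≰c)) (L-long (<-trans (≰⇒> e≰c) (<-trans (n<1+n e) 1+e<q)))) (size-odds-even t)
  ... | yes e≤c | no e≮c | _ =
    trans (cong₂ size (trans (cong T c≡e) T-at-e) (L-long (subst (_< q) (sym c≡e) (<-trans (n<1+n e) 1+e<q))))
          (size-evens-even t)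
    where
    c≡e = ≤-antisym (≤-pred (≰⇒> e≮c)) e≤c
  ... | yes _ | yes e<c | no r≮c =
    trans (cong₂ size (T-mid e<c (≰⇒> r≮c)) (L-long (<-≤-trans (≰⇒> r≮c) 1+r≤q))) (size-odds-even t)
  ... | yes _ | yes _ | yes r<c with q ≤? c
  ...   | no q≰c = trans (cong₂ size (T-high r<c) (L-long (≰⇒> q≰c))) (size-evens-even t)
  ...   | yes q≤c = trans (cong₂ size (T-high r<c) (L-short q≤c)) (size-evens-odd t)

  firsts : ∀ c → suc r ≤ c → c < m → SelectsFirst (T c)
  firsts c r<c c<m = selectsFirst c (T-high r<c) (λ _ → refl)

  lasts : ∀ c → c < m → EndsRightForced c → SelectsLast c
  lasts c c<m (inj₁ (q≤c , _)) = selectsLast-odd c t (L-short q≤c) (T-high (≤-trans 1+r≤q q≤c)) evens-selectsEvens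
  lasts c c<m (inj₂ c+m<q+r) =
    selectsLast-even c t (L-long (<-trans c<e (<-trans (n<1+n e) 1+e<q))) (T-low c<e) odds-selectsOdds
    where
    c<e = +-cancelʳ-< m c e (subst (c + m <_) q+r≡e+m c+m<q+r)

  upper : Σ (Subset n) λ D → IsIdCode r n D × ∣ D ∣ ≡ m * suc t
  upper =
    let D , ic , ∣D∣≡∑ = design (λ _ → suc t) size-T firsts lasts
          (e , <⇒≤ e<r , selectsFirst e T-at-e (λ _ → refl))
          (suc e , suc r , <-trans 1+e<q (s≤s q≤r+r) , n≤1+n r , s≤s (m<m+n r r≥1) , inj₂ q+1+r≡1+e+m ,
           selectsLast-even (suc e) t (L-long 1+e<q) (T-mid ≤-refl (s≤s e<r)) odds-selectsOdds)
          (0 , e , suc e , e≥1 , n<1+n e , <-trans 1+e<q (s≤s q≤r+r) ,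
           inj₂ (subst SelectsOdds (sym (T-low e≥1)) odds-selectsOdds ,
                 subst SelectsEvens (sym T-at-e) evens-selectsEvens ,
                 subst SelectsOdds (sym (T-mid ≤-refl (s≤s e<r))) odds-selectsOdds))
    in D , ic , trans ∣D∣≡∑ (∑-const (suc t) m)
    where
    q+1+r≡1+e+m : q + suc r ≡ suc e + m
    q+1+r≡1+e+m = regroup r e
      where
      regroup : ∀ r e → suc r + e + suc r ≡ suc e + suc (r + r)
      regroup = solve-∀

  minIdCodeSize : MinIdCodeSize r n (m * suc t)
  minIdCodeSize = upper , lower

even-form : ∀ p → 1 ≤ p → p % 2 ≡ 0 → Σ ℕ λ t → p ≡ suc (suc (2 * t))
even-form p 1≤p p%2≡0 with p / 2 | trans (m≡m%n+[m/n]*n p 2) (trans (cong (_+ (p / 2) * 2) p%2≡0) (*-comm (p / 2) 2))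
... | zero | p≡0 = ⊥-elim (<⇒≢ 1≤p (sym p≡0))
... | suc t | p≡2+2t = t , trans p≡2+2t (2*-suc t)

odd-form : ∀ p → p % 2 ≡ 1 → Σ ℕ λ t → p ≡ suc (2 * t)
odd-form p p%2≡1 = p / 2 , trans (m≡m%n+[m/n]*n p 2) (trans (cong (_+ (p / 2) * 2) p%2≡1) (cong suc (*-comm (p / 2) 2)))

smallRemainder-form : ∀ r q → 1 ≤ q → q ≤ r + 1 → Σ ℕ λ q' → q ≡ suc q' × q' ≤ r
smallRemainder-form r (suc q') _ q≤r+1 = q' , refl , ≤-pred (subst (suc q' ≤_) (+-comm r 1) q≤r+1)

largeRemainder-form : ∀ r q → r + 2 ≤ q → q ≤ 2 * r → Σ ℕ λ e → q ≡ suc r + e × 1 ≤ e × suc r + e ≤ r + r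
largeRemainder-form r q r+2≤q q≤2r =
  q ∸ suc r , sym q≡ , 1≤e , subst (_≤ r + r) (sym q≡) (subst (q ≤_) (cong (r +_) (+-identityʳ r)) q≤2r)
  where
  1+r≤q : suc r ≤ q
  1+r≤q = ≤-trans (≤-trans (n≤1+n (suc r)) (≤-reflexive (+-comm 2 r))) r+2≤q
  q≡ : suc r + (q ∸ suc r) ≡ q
  q≡ = m+[n∸m]≡n 1+r≤q
  1≤e : 1 ≤ q ∸ suc r
  1≤e = +-cancelˡ-≤ (suc r) 1 (q ∸ suc r) (≤-trans (≤-reflexive (sym (+-suc r 1))) (≤-trans r+2≤q (≤-reflexive (sym q≡))))

pathLength≡ : ∀ r p' q → (2 * r + 1) * suc p' + q ≡ p' * suc (r + r) + q + suc (r + r)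
pathLength≡ = solve-∀

half-even : ∀ r t → ((2 * r + 1) * suc (suc (2 * t))) / 2 ≡ suc (r + r) * suc t
half-even r t = trans (cong (_/ 2) (regroup r t)) (m*n/n≡m (suc (r + r) * suc t) 2)
  where
  regroup : ∀ r t → (2 * r + 1) * suc (suc (2 * t)) ≡ suc (r + r) * suc t * 2
  regroup = solve-∀

half-odd : ∀ r t → ((2 * r + 1) * (suc (2 * t) ∸ 1)) / 2 ≡ suc (r + r) * t
half-odd r t = trans (cong (_/ 2) (regroup r t)) (m*n/n≡m (suc (r + r) * t) 2)
  where
  regroup : ∀ r t → (2 * r + 1) * (2 * t) ≡ suc (r + r) * t * 2
  regroup = solve-∀

m*t+2r+1≡m*[1+t] : ∀ r t → suc (r + r) * t + 2 * r + 1 ≡ suc (r + r) * suc t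
m*t+2r+1≡m*[1+t] = solve-∀

noRemainder-even : ∀ r p q → 1 ≤ r → 1 ≤ p → q ≡ 0 → p % 2 ≡ 0 →
                   MinIdCodeSize r ((2 * r + 1) * p + q) (((2 * r + 1) * p) / 2 + 1)
noRemainder-even r p .0 1≤r 1≤p refl p%2≡0 with even-form p 1≤p p%2≡0
... | t , refl = subst₂ (MinIdCodeSize r) (sym (pathLength≡ r (suc (2 * t)) 0)) (sym (cong (_+ 1) (half-even r t)))
                        (NoRemainderEven.minIdCodeSize r t 1≤r)

noRemainder-odd : ∀ r p q → 1 ≤ r → q ≡ 0 → p % 2 ≡ 1 →
                  MinIdCodeSize r ((2 * r + 1) * p + q) (((2 * r + 1) * (p ∸ 1)) / 2 + 2 * r)
noRemainder-odd r p .0 1≤r refl p%2≡1 with odd-form p p%2≡1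
... | t , refl = subst₂ (MinIdCodeSize r) (sym (pathLength≡ r (2 * t) 0))
                        (sym (cong₂ _+_ (half-odd r t) (cong (r +_) (+-identityʳ r))))
                        (NoRemainderOdd.minIdCodeSize r t 1≤r)

smallRemainder-even : ∀ r p q → 1 ≤ r → 1 ≤ p → 1 ≤ q → q ≤ r + 1 → p % 2 ≡ 0 →
                      MinIdCodeSize r ((2 * r + 1) * p + q) (((2 * r + 1) * p) / 2 + q)
smallRemainder-even r p q 1≤r 1≤p 1≤q q≤r+1 p%2≡0 with even-form p 1≤p p%2≡0 | smallRemainder-form r q 1≤q q≤r+1
... | t , refl | q' , refl , q'≤r =
  subst₂ (MinIdCodeSize r) (sym (pathLength≡ r (suc (2 * t)) (suc q'))) (sym (cong (_+ suc q') (half-even r t)))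
         (SmallRemainderEven.minIdCodeSize r t q' 1≤r q'≤r)

smallRemainder-odd : ∀ r p q → 1 ≤ r → 1 ≤ q → q ≤ r + 1 → p % 2 ≡ 1 →
                     MinIdCodeSize r ((2 * r + 1) * p + q) (((2 * r + 1) * (p ∸ 1)) / 2 + 2 * r + 1)
smallRemainder-odd r p q 1≤r 1≤q q≤r+1 p%2≡1 with odd-form p p%2≡1 | smallRemainder-form r q 1≤q q≤r+1
... | t , refl | q' , refl , q'≤r =
  subst₂ (MinIdCodeSize r) (sym (pathLength≡ r (2 * t) (suc q')))
         (sym (trans (cong (λ z → z + 2 * r + 1) (half-odd r t)) (m*t+2r+1≡m*[1+t] r t)))
         (SmallRemainderOdd.minIdCodeSize r t q' 1≤r q'≤r)

largeRemainder-even : ∀ r p q → 1 ≤ p → q ≤ 2 * r → r + 2 ≤ q → p % 2 ≡ 0 →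
                      MinIdCodeSize r ((2 * r + 1) * p + q) (((2 * r + 1) * p) / 2 + q ∸ 1)
largeRemainder-even r p q 1≤p q≤2r r+2≤q p%2≡0 with even-form p 1≤p p%2≡0 | largeRemainder-form r q r+2≤q q≤2r
... | t , refl | e , refl , 1≤e , q≤r+r =
  subst₂ (MinIdCodeSize r) (sym (pathLength≡ r (suc (2 * t)) (suc r + e)))
         (sym (trans (cong (λ z → z + (suc r + e) ∸ 1) (half-even r t))
                     (trans (cong (_∸ 1) (+-suc (suc (r + r) * suc t) (r + e)))
                            (cong (suc (r + r) * suc t +_) (+-comm r e)))))
         (LargeRemainderEven.minIdCodeSize r t e 1≤e q≤r+r)

largeRemainder-odd : ∀ r p q → q ≤ 2 * r → r + 2 ≤ q → p % 2 ≡ 1 →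
                     MinIdCodeSize r ((2 * r + 1) * p + q) (((2 * r + 1) * (p ∸ 1)) / 2 + 2 * r + 1)
largeRemainder-odd r p q q≤2r r+2≤q p%2≡1 with odd-form p p%2≡1 | largeRemainder-form r q r+2≤q q≤2r
... | t , refl | e , refl , 1≤e , q≤r+r =
  subst₂ (MinIdCodeSize r) (sym (pathLength≡ r (2 * t) (suc r + e)))
         (sym (trans (cong (λ z → z + 2 * r + 1) (half-odd r t)) (m*t+2r+1≡m*[1+t] r t)))
         (LargeRemainderOdd.minIdCodeSize r t e 1≤e q≤r+r)

theorem11 : (r p q : ℕ) → 1 ≤ r → 1 ≤ p → q ≤ 2 * r →
    ((q ≡ 0 → p % 2 ≡ 0 →
        MinIdCodeSize r ((2 * r + 1) * p + q) (((2 * r + 1) * p) / 2 + 1)) ×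
     (q ≡ 0 → p % 2 ≡ 1 →
        MinIdCodeSize r ((2 * r + 1) * p + q) (((2 * r + 1) * (p ∸ 1)) / 2 + 2 * r)) ×
     (1 ≤ q → q ≤ r + 1 → p % 2 ≡ 0 →
        MinIdCodeSize r ((2 * r + 1) * p + q) (((2 * r + 1) * p) / 2 + q)) ×
     (1 ≤ q → q ≤ r + 1 → p % 2 ≡ 1 →
        MinIdCodeSize r ((2 * r + 1) * p + q) (((2 * r + 1) * (p ∸ 1)) / 2 + 2 * r + 1)) ×
     (r + 2 ≤ q → p % 2 ≡ 0 →
        MinIdCodeSize r ((2 * r + 1) * p + q) (((2 * r + 1) * p) / 2 + q ∸ 1)) ×
     (r + 2 ≤ q → p % 2 ≡ 1 →
        MinIdCodeSize r ((2 * r + 1) * p + q) (((2 * r + 1) * (p ∸ 1)) / 2 + 2 * r + 1)))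
theorem11 r p q 1≤r 1≤p q≤2r =
  noRemainder-even r p q 1≤r 1≤p ,
  noRemainder-odd r p q 1≤r ,
  smallRemainder-even r p q 1≤r 1≤p ,
  smallRemainder-odd r p q 1≤r ,
  largeRemainder-even r p q 1≤p q≤2r ,
  largeRemainder-odd r p q q≤2r
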